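{- Let $\phi=(1+\sqrt5)/2$. Let $T$ be a tree of stars and let $v$ be a leaf of $T$. Then $F(T) > \phi\cdot F(T-v)$. Moreover, this remains true if $T$ is almost a tree of stars, provided $v$ is not the exposed center of $T$.
   Context: $F(G)$ is the number of stable sets of a graph $G$, including the empty set (so $F$ of the empty graph is $1$). A leaf of a tree is a vertex of degree at most $1$. Trees of stars are defined inductively: a single vertex is a tree of stars; if $T_1,\dots,T_k$ ($k\ge2$) are disjoint trees of stars and $v_i$ is a leaf of $T_i$, then adding a new vertex $w$ adjacent to all $v_i$ gives a tree of stars. In a tree of stars, a vertex is a center if its distances to all leaves are odd (these distances all have the same parity). A tree $T$ is almost a tree of stars if $T$ is not a path and $T$ has a leaf $w$ such that the tree obtained by adding a new vertex adjacent to $w$ is a tree of stars $T'$; the centers of $T$ are then the centers of $T'$ (this is well defined), and $w$ (the unique center of $T$ that is a leaf) is the exposed center of $T$. -}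

module Defs where

open import Data.Nat using (ℕ; zero; suc; _+_; _*_; _≤_; _<_; _≡ᵇ_)
open import Data.Bool using (Bool; true; false; if_then_else_; not; _∧_; _∨_)
open import Data.Fin using (Fin; zero; suc; toℕ; splitAt; punchIn; _≟_)
open import Data.Fin.Permutation using (Permutation′; _⟨$⟩ʳ_)
open import Data.Sum using (_⊎_; inj₁; inj₂)
open import Relation.Nullary.Decidable using (⌊_⌋)
open import Relation.Binary.PropositionalEquality using (_≡_)

Graph : ℕ → Set
Graph n = Fin n → Fin n → Bool

countFin : ∀ n → (Fin n → Bool) → ℕ
countFin zero    f = 0
countFin (suc n) f = (if f zero then 1 else 0) + countFin n (λ i → f (suc i))

allB : ∀ n → (Fin n → Bool) → Bool
allB zero    f = true
allB (suc n) f = f zero ∧ allB n (λ i → f (suc i))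

consB : ∀ {n} → Bool → (Fin n → Bool) → Fin (suc n) → Bool
consB b S zero    = b
consB b S (suc i) = S i

countSubsets : ∀ n → ((Fin n → Bool) → Bool) → ℕ
countSubsets zero    P = if P (λ ()) then 1 else 0
countSubsets (suc n) P =
  countSubsets n (λ S → P (consB false S)) + countSubsets n (λ S → P (consB true S))

isStable : ∀ {n} → Graph n → (Fin n → Bool) → Bool
isStable {n} G S = allB n (λ x → allB n (λ y → not (S x ∧ S y ∧ G x y)))

F : ∀ {n} → Graph n → ℕ
F {n} G = countSubsets n (isStable G)

degree : ∀ {n} → Graph n → Fin n → ℕ
degree {n} G u = countFin n (G u)

IsLeaf : ∀ {n} → Graph n → Fin n → Set
IsLeaf G u = degree G u ≤ 1

removeVertex : ∀ {m} → Graph (suc m) → Fin (suc m) → Graph m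
removeVertex G v x y = G (punchIn v x) (punchIn v y)

emptyGraph : Graph 0
emptyGraph ()

duAdj : ∀ {m n} → Graph m → Graph n → Fin m ⊎ Fin n → Fin m ⊎ Fin n → Bool
duAdj G H (inj₁ a) (inj₁ b) = G a b
duAdj G H (inj₂ a) (inj₂ b) = H a b
duAdj G H (inj₁ _) (inj₂ _) = false
duAdj G H (inj₂ _) (inj₁ _) = false

disjointUnion : ∀ {m n} → Graph m → Graph n → Graph (m + n)
disjointUnion {m} G H x y = duAdj G H (splitAt m x) (splitAt m y)

addVertex : ∀ {n} → (Fin n → Bool) → Graph n → Graph (suc n)
addVertex A G zero    zero    = false
addVertex A G zero    (suc y) = A y
addVertex A G (suc x) zero    = A x
addVertex A G (suc x) (suc y) = G x y

attach : ∀ {m n} → Fin m → (Fin n → Bool) → Fin (m + n) → Bool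
attach {m} v A x with splitAt m x
... | inj₁ a = ⌊ a ≟ v ⌋
... | inj₂ b = A b

mutual
  data TreeOfStars : (n : ℕ) → Graph n → Set where
    single  : TreeOfStars 1 (λ _ _ → false)
    glue    : ∀ {k N G A} → 2 ≤ k → StarForest k N G A → TreeOfStars (suc N) (addVertex A G)
    relabel : ∀ {n G H} → TreeOfStars n G → (σ : Permutation′ n) →
              (∀ x y → H x y ≡ G (σ ⟨$⟩ʳ x) (σ ⟨$⟩ʳ y)) → TreeOfStars n H

  -- StarForest k N G A : G is the disjoint union of k trees of stars T₁..T_k
  -- (N vertices in total), A marks the chosen leaf vᵢ of each Tᵢ
  data StarForest : (k N : ℕ) → Graph N → (Fin N → Bool) → Set where
    nil  : StarForest 0 0 emptyGraph (λ ())
    cons : ∀ {n k N T G A} → TreeOfStars n T → (v : Fin n) → IsLeaf T v →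
           StarForest k N G A →
           StarForest (suc k) (n + N) (disjointUnion T G) (attach v A)

pathGraph : ∀ n → Graph n
pathGraph n i j = (toℕ i ≡ᵇ suc (toℕ j)) ∨ (toℕ j ≡ᵇ suc (toℕ i))

IsPath : ∀ {n} → Graph n → Set
IsPath {n} G = Σ′ (Permutation′ n) (λ σ → ∀ x y → G x y ≡ pathGraph n (σ ⟨$⟩ʳ x) (σ ⟨$⟩ʳ y))
  where
    open import Data.Product using () renaming (Σ to Σ′)

addPendant : ∀ {n} → Graph n → Fin n → Graph (suc n)
addPendant G w = addVertex (λ y → ⌊ y ≟ w ⌋) G

-- a > φ·b  with φ = (1+√5)/2, for natural numbers a, b:
-- equivalent to a² > a·b + b²  (since (a - φb)(a + b/φ) = a² - ab - b²)
_>φ·_ : ℕ → ℕ → Set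
a >φ· b = a * b + b * b < a * a

{-# OPTIONS --safe #-}

-- Let Z(G; p, q) be the sum over stable sets S of ∏_{j ∈ S} p j · ∏_{j ∉ S} q j, so that F G = Z(G; 1, 1). For a
-- leaf v, F (T - v) is the part Zout of Z(T; 1, 1) with v ∉ S and the rest is Zin, so it suffices that Zout < φ Zin.
-- This is proved by induction along the construction of trees of stars, for all weights where every other leaf
-- carries a weight (p, q) with q < φ p and every inner vertex carries (1, 1). A subtree hanging from a vertex sums
-- out into exactly such a leaf weight, because 1 + 1/φ = φ, and Z is multiplicative over the components glued
-- at a new centre.
-- An almost tree of stars is a tree of stars with an extra leaf of weight (0, 1). The induction is therefore
-- strengthened to allow one leaf with arbitrary weight, at the cost of an exception when the whole tree is a
-- path between the two distinguished leaves; the exception is the excluded case that T is a path.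

module Submission where

open import Defs
import Algebra.Properties.CommutativeMonoid.Sum as CommutativeMonoidSum
open import Data.Bool using (Bool; true; false; if_then_else_; not; _∧_; _∨_)
open import Data.Bool.Properties using (T-≡; T-∨)
open import Data.Empty using (⊥; ⊥-elim)
open import Data.Fin using (Fin; zero; suc; toℕ; fromℕ<; splitAt; punchIn; punchOut; _↑ˡ_; _↑ʳ_)
open import Data.Fin.Permutation using (Permutation′; _⟨$⟩ʳ_; _⟨$⟩ˡ_; remove; inverseʳ; inverseˡ; punchIn-permute; flip; permutation)
open import Data.Fin.Properties using (splitAt-↑ˡ; splitAt-↑ʳ; punchInᵢ≢i; punchIn-punchOut; _≟_; ↑ˡ-injective; ↑ʳ-injective; splitAt⁻¹-↑ˡ; splitAt⁻¹-↑ʳ; suc-injective; toℕ-fromℕ<; any?; injective⇒≤; punchOut-injective)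
open import Data.Nat using (ℕ; zero; suc; _+_; _*_; _≤_; _<_; z≤n; s≤s; _∸_; _≡ᵇ_; NonZero; _<?_; _≤?_)
open import Data.Nat.Properties hiding (suc-injective) renaming (_≟_ to _≟ℕ_)
open import Algebra.Properties.CommutativeSemigroup +-commutativeSemigroup using () renaming (interchange to +-interchange)
open import Algebra.Properties.CommutativeSemigroup *-commutativeSemigroup using () renaming (x∙yz≈y∙xz to *-left-comm)
import Data.Nat.Properties as ℕ
open import Data.Nat.Tactic.RingSolver using (solve-∀)
open import Data.Product using (Σ; _×_; _,_; proj₁; proj₂; ∃)
open import Data.Sum as Sum using (_⊎_; inj₁; inj₂; [_,_]′)
open import Data.Unit using (⊤; tt)
open import Data.Vec.Functional using (Vector; insertAt; _++_)
open import Data.Vec.Functional.Properties using (insertAt-lookup; insertAt-punchIn; lookup-++ˡ; lookup-++ʳ)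
open import Function using (_∘_; id; Equivalence; _⇔_; mk⇔)
open import Relation.Binary.PropositionalEquality
open import Relation.Nullary using (¬_; yes; no; Dec)
open import Relation.Nullary.Decidable using (⌊_⌋)

private
  module Mul = CommutativeMonoidSum *-1-commutativeMonoid
  module Add = CommutativeMonoidSum +-0-commutativeMonoid


-- Sums over subsets, products and counts

𝟙 : Bool → ℕ
𝟙 b = if b then 1 else 0

𝟙-∧ : ∀ a b → 𝟙 (a ∧ b) ≡ 𝟙 a * 𝟙 b
𝟙-∧ true  b = sym (*-identityˡ (𝟙 b))
𝟙-∧ false b = refl

Subset : ℕ → Set
Subset = Vector Bool

Extensional : ∀ {n} {A : Set} → (Subset n → A) → Set
Extensional f = ∀ S S′ → S ≗ S′ → f S ≡ f S′

Extensional-consB : ∀ {n} {A : Set} {f : Subset (suc n) → A} → Extensional f →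
                    ∀ b → Extensional (λ S → f (consB b S))
Extensional-consB ext b S S′ S≗S′ = ext _ _ λ { zero → refl ; (suc j) → S≗S′ j }

sumSubsets : ∀ n → (Subset n → ℕ) → ℕ
sumSubsets zero    f = f (λ ())
sumSubsets (suc n) f = sumSubsets n (λ S → f (consB false S)) + sumSubsets n (λ S → f (consB true S))

sumSubsets-cong : ∀ n {f g : Subset n → ℕ} → (∀ S → f S ≡ g S) → sumSubsets n f ≡ sumSubsets n g
sumSubsets-cong zero    f≗g = f≗g _
sumSubsets-cong (suc n) f≗g = cong₂ _+_ (sumSubsets-cong n (λ _ → f≗g _)) (sumSubsets-cong n (λ _ → f≗g _))

sumSubsets-mono : ∀ n {f g : Subset n → ℕ} → (∀ S → f S ≤ g S) → sumSubsets n f ≤ sumSubsets n g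
sumSubsets-mono zero    f≤g = f≤g _
sumSubsets-mono (suc n) f≤g = +-mono-≤ (sumSubsets-mono n (λ _ → f≤g _)) (sumSubsets-mono n (λ _ → f≤g _))

sumSubsets-+ : ∀ n (f g : Subset n → ℕ) → sumSubsets n (λ S → f S + g S) ≡ sumSubsets n f + sumSubsets n g
sumSubsets-+ zero    f g = refl
sumSubsets-+ (suc n) f g
  rewrite sumSubsets-+ n (λ S → f (consB false S)) (λ S → g (consB false S))
        | sumSubsets-+ n (λ S → f (consB true S)) (λ S → g (consB true S))
  = +-interchange (sumSubsets n (λ S → f (consB false S))) (sumSubsets n (λ S → g (consB false S)))
                  (sumSubsets n (λ S → f (consB true S))) (sumSubsets n (λ S → g (consB true S)))

sumSubsets-*ˡ : ∀ n c (f : Subset n → ℕ) → sumSubsets n (λ S → c * f S) ≡ c * sumSubsets n f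
sumSubsets-*ˡ zero    c f = refl
sumSubsets-*ˡ (suc n) c f
  rewrite sumSubsets-*ˡ n c (λ S → f (consB false S)) | sumSubsets-*ˡ n c (λ S → f (consB true S))
  = sym (*-distribˡ-+ c _ _)

sumSubsets-*ʳ : ∀ n c (f : Subset n → ℕ) → sumSubsets n (λ S → f S * c) ≡ sumSubsets n f * c
sumSubsets-*ʳ n c f = begin
  sumSubsets n (λ S → f S * c) ≡⟨ sumSubsets-cong n (λ S → *-comm (f S) c) ⟩
  sumSubsets n (λ S → c * f S) ≡⟨ sumSubsets-*ˡ n c f ⟩
  c * sumSubsets n f           ≡⟨ *-comm c _ ⟩
  sumSubsets n f * c           ∎
  where open ≡-Reasoning

sumSubsets-≥-empty : ∀ n (f : Subset n → ℕ) → Extensional f → f (λ _ → false) ≤ sumSubsets n f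
sumSubsets-≥-empty zero    f ext = ≤-reflexive (ext _ _ (λ ()))
sumSubsets-≥-empty (suc n) f ext = begin
  f (λ _ → false)                               ≡⟨ ext _ _ (λ { zero → refl ; (suc _) → refl }) ⟩
  f (consB false (λ _ → false))                 ≤⟨ sumSubsets-≥-empty n _ (Extensional-consB ext false) ⟩
  sumSubsets n (λ S → f (consB false S))        ≤⟨ m≤m+n _ _ ⟩
  sumSubsets (suc n) f                          ∎
  where open ≤-Reasoning

sumSubsets-insertAt : ∀ n (i : Fin (suc n)) (f : Subset (suc n) → ℕ) → Extensional f →
                      sumSubsets (suc n) f ≡ sumSubsets n (λ S → f (insertAt S i false)) + sumSubsets n (λ S → f (insertAt S i true))
sumSubsets-insertAt n zero f ext =
  cong₂ _+_ (sumSubsets-cong n (λ S → ext _ _ (λ { zero → refl ; (suc _) → refl })))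
            (sumSubsets-cong n (λ S → ext _ _ (λ { zero → refl ; (suc _) → refl })))
sumSubsets-insertAt (suc n) (suc i) f ext
  rewrite sumSubsets-insertAt n i (λ S → f (consB false S)) (Extensional-consB ext false)
        | sumSubsets-insertAt n i (λ S → f (consB true S)) (Extensional-consB ext true)
  = trans (+-interchange (half false false) (half false true) (half true false) (half true true))
          (cong₂ _+_ (cong₂ _+_ (shift false false) (shift true false))
                     (cong₂ _+_ (shift false true) (shift true true)))
  where
    half : Bool → Bool → ℕ
    half c b = sumSubsets n (λ S → f (consB c (insertAt S i b)))
    shift : ∀ c b → sumSubsets n (λ S → f (consB c (insertAt S i b)))
                  ≡ sumSubsets n (λ S → f (insertAt (consB c S) (suc i) b))
    shift c b = sumSubsets-cong n (λ S → ext _ _ (λ { zero → refl ; (suc _) → refl }))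

sumSubsets-permute : ∀ n (π : Permutation′ n) (f : Subset n → ℕ) → Extensional f →
                     sumSubsets n (λ S → f (λ x → S (π ⟨$⟩ʳ x))) ≡ sumSubsets n f
sumSubsets-permute zero    π f ext = ext _ _ (λ ())
sumSubsets-permute (suc n) π f ext =
  trans (sumSubsets-insertAt n i (λ S → f (λ x → S (π ⟨$⟩ʳ x))) (λ S S′ S≗S′ → ext _ _ (S≗S′ ∘ (π ⟨$⟩ʳ_))))
        (cong₂ _+_ (permuted false) (permuted true))
  where
    i = π ⟨$⟩ʳ zero
    π′ = remove zero π
    lookup-permuted : ∀ b S x → insertAt S i b (π ⟨$⟩ʳ x) ≡ consB b (λ y → S (π′ ⟨$⟩ʳ y)) x
    lookup-permuted b S zero    = insertAt-lookup S i b
    lookup-permuted b S (suc j) = trans (cong (insertAt S i b) (punchIn-permute π zero j)) (insertAt-punchIn S i b _)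
    permuted : ∀ b → sumSubsets n (λ S → f (λ x → insertAt S i b (π ⟨$⟩ʳ x))) ≡ sumSubsets n (λ S → f (consB b S))
    permuted b = trans (sumSubsets-cong n (λ S → ext _ _ (lookup-permuted b S)))
                       (sumSubsets-permute n π′ (λ S → f (consB b S)) (Extensional-consB ext b))

sumSubsets-++ : ∀ m n (f : Subset (m + n) → ℕ) → Extensional f →
                sumSubsets (m + n) f ≡ sumSubsets m (λ A → sumSubsets n (λ B → f (A ++ B)))
sumSubsets-++ zero    n f ext = sumSubsets-cong n (λ B → ext _ _ (λ _ → refl))
sumSubsets-++ (suc m) n f ext = cong₂ _+_ (split false) (split true)
  where
    consB-++ : ∀ b (A : Subset m) (B : Subset n) → consB b (A ++ B) ≗ consB b A ++ B
    consB-++ b A B zero = refl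
    consB-++ b A B (suc j) with splitAt m j
    ... | inj₁ _ = refl
    ... | inj₂ _ = refl
    split : ∀ b → sumSubsets (m + n) (λ S → f (consB b S))
                ≡ sumSubsets m (λ A → sumSubsets n (λ B → f (consB b A ++ B)))
    split b = trans (sumSubsets-++ m n _ (Extensional-consB ext b))
                    (sumSubsets-cong m (λ A → sumSubsets-cong n (λ B → ext _ _ (consB-++ b A B))))

∏ : ∀ n → (Fin n → ℕ) → ℕ
∏ _ = Mul.sum

∏-mono : ∀ n {f g : Fin n → ℕ} → (∀ i → f i ≤ g i) → ∏ n f ≤ ∏ n g
∏-mono zero    f≤g = ≤-refl
∏-mono (suc n) f≤g = *-mono-≤ (f≤g zero) (∏-mono n (f≤g ∘ suc))

∏-positive : ∀ n (f : Fin n → ℕ) → (∀ i → 0 < f i) → 0 < ∏ n f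
∏-positive zero    f f>0 = s≤s z≤n
∏-positive (suc n) f f>0 = *-mono-< (f>0 zero) (∏-positive n (f ∘ suc) (f>0 ∘ suc))

∏-↑ : ∀ m n (f : Fin (m + n) → ℕ) → ∏ (m + n) f ≡ ∏ m (λ i → f (i ↑ˡ n)) * ∏ n (λ j → f (m ↑ʳ j))
∏-↑ zero    n f = sym (+-identityʳ _)
∏-↑ (suc m) n f rewrite ∏-↑ m n (f ∘ suc) = sym (*-assoc (f zero) _ _)

countFin≡sum : ∀ n (f : Fin n → Bool) → countFin n f ≡ Add.sum (λ i → 𝟙 (f i))
countFin≡sum zero    f = refl
countFin≡sum (suc n) f = cong (𝟙 (f zero) +_) (countFin≡sum n (f ∘ suc))

countFin-cong : ∀ n {f g : Fin n → Bool} → (∀ i → f i ≡ g i) → countFin n f ≡ countFin n g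
countFin-cong zero    f≗g = refl
countFin-cong (suc n) f≗g = cong₂ _+_ (cong 𝟙 (f≗g zero)) (countFin-cong n (f≗g ∘ suc))

countFin-permute : ∀ n (π : Permutation′ n) (f : Fin n → Bool) → countFin n (λ i → f (π ⟨$⟩ʳ i)) ≡ countFin n f
countFin-permute n π f = begin
  countFin n (λ i → f (π ⟨$⟩ʳ i))    ≡⟨ countFin≡sum n _ ⟩
  Add.sum (λ i → 𝟙 (f (π ⟨$⟩ʳ i)))    ≡⟨ Add.sum-permute (λ i → 𝟙 (f i)) π ⟨
  Add.sum (λ i → 𝟙 (f i))             ≡⟨ countFin≡sum n f ⟨
  countFin n f                      ∎
  where open ≡-Reasoning

countFin-↑ : ∀ m n (f : Fin (m + n) → Bool) →
             countFin (m + n) f ≡ countFin m (λ i → f (i ↑ˡ n)) + countFin n (λ j → f (m ↑ʳ j))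
countFin-↑ zero    n f = refl
countFin-↑ (suc m) n f rewrite countFin-↑ m n (f ∘ suc) = sym (+-assoc (𝟙 (f zero)) _ _)

countFin-false : ∀ n → countFin n (λ _ → false) ≡ 0
countFin-false zero    = refl
countFin-false (suc n) = countFin-false n

countFin≡0 : ∀ n (f : Fin n → Bool) → countFin n f ≡ 0 → ∀ i → f i ≡ false
countFin≡0 (suc n) f count≡0 zero    with f zero
... | false = refl
countFin≡0 (suc n) f count≡0 (suc i) with f zero
... | false = countFin≡0 n (f ∘ suc) count≡0 i

countFin-≟ : ∀ n (v : Fin n) → countFin n (λ i → ⌊ i ≟ v ⌋) ≡ 1
countFin-≟ (suc n) zero    = cong suc (trans (countFin-cong n (λ _ → refl)) (countFin-false n))
countFin-≟ (suc n) (suc v) = trans (countFin-cong n ≟-suc) (countFin-≟ n v)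
  where
    ≟-suc : ∀ i → ⌊ suc i ≟ suc v ⌋ ≡ ⌊ i ≟ v ⌋
    ≟-suc i with i ≟ v
    ... | yes refl = refl
    ... | no _     = refl

-- Stable sets and the weighted independence polynomial

true⇔true⇒≡ : ∀ {b c : Bool} → (b ≡ true → c ≡ true) → (c ≡ true → b ≡ true) → b ≡ c
true⇔true⇒≡ {false} {false} _   _   = refl
true⇔true⇒≡ {false} {true}  _   c⇒b = c⇒b refl
true⇔true⇒≡ {true}  {false} b⇒c _   = sym (b⇒c refl)
true⇔true⇒≡ {true}  {true}  _   _   = refl

allB⇒ : ∀ n {f : Fin n → Bool} → allB n f ≡ true → ∀ i → f i ≡ true
allB⇒ (suc n) {f} all zero    with f zero | all
... | true | _    = refl
allB⇒ (suc n) {f} all (suc i) with f zero | all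
... | true | all′ = allB⇒ n all′ i

⇒allB : ∀ n {f : Fin n → Bool} → (∀ i → f i ≡ true) → allB n f ≡ true
⇒allB zero    all = refl
⇒allB (suc n) all rewrite all zero = ⇒allB n (all ∘ suc)

∧⇒ : ∀ {a b} → (a ∧ b) ≡ true → a ≡ true × b ≡ true
∧⇒ {true} {true} _ = refl , refl

⇒∧ : ∀ {a b} → a ≡ true → b ≡ true → (a ∧ b) ≡ true
⇒∧ refl refl = refl

Stable : ∀ {n} → Graph n → Subset n → Set
Stable G S = ∀ x y → S x ≡ true → S y ≡ true → G x y ≡ false

isStable⇒Stable : ∀ {n} (G : Graph n) S → isStable G S ≡ true → Stable G S
isStable⇒Stable {n} G S stable x y x∈S y∈S with G x y in Gxy
... | false = refl
... | true with allB⇒ n (allB⇒ n stable x) y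
... | not-edge rewrite x∈S | y∈S | Gxy = ⊥-elim (false≢true not-edge)
  where
    false≢true : false ≡ true → ⊥
    false≢true ()

Stable⇒isStable : ∀ {n} (G : Graph n) S → Stable G S → isStable G S ≡ true
Stable⇒isStable {n} G S stable = ⇒allB n (λ x → ⇒allB n (not-edge x))
  where
    not-edge : ∀ x y → not (S x ∧ S y ∧ G x y) ≡ true
    not-edge x y with S x in x∈S | S y in y∈S
    ... | false | _     = refl
    ... | true  | false = refl
    ... | true  | true  rewrite stable x y x∈S y∈S = refl

isStable-≡ : ∀ {n m} (G : Graph n) (H : Graph m) S S′ →
             (Stable G S → Stable H S′) → (Stable H S′ → Stable G S) → isStable G S ≡ isStable H S′
isStable-≡ G H S S′ G⇒H H⇒G =
  true⇔true⇒≡ (λ st → Stable⇒isStable H S′ (G⇒H (isStable⇒Stable G S st)))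
              (λ st → Stable⇒isStable G S (H⇒G (isStable⇒Stable H S′ st)))

isStable-extensional : ∀ {n} (G : Graph n) → Extensional (isStable G)
isStable-extensional G S S′ S≗S′ = isStable-≡ G G S S′
  (λ st x y x∈S′ y∈S′ → st x y (trans (S≗S′ x) x∈S′) (trans (S≗S′ y) y∈S′))
  (λ st x y x∈S y∈S → st x y (trans (sym (S≗S′ x)) x∈S) (trans (sym (S≗S′ y)) y∈S))

weight : ∀ {n} → (Fin n → ℕ) → (Fin n → ℕ) → Subset n → ℕ
weight {n} p q S = ∏ n (λ j → if S j then p j else q j)

stableWeight : ∀ {n} → Graph n → (Fin n → ℕ) → (Fin n → ℕ) → Subset n → ℕ
stableWeight G p q S = 𝟙 (isStable G S) * weight p q S

Z : ∀ {n} → Graph n → (Fin n → ℕ) → (Fin n → ℕ) → ℕ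
Z {n} G p q = sumSubsets n (stableWeight G p q)

weight-extensional : ∀ {n} (p q : Fin n → ℕ) → Extensional (weight p q)
weight-extensional {n} p q S S′ S≗S′ = Mul.sum-cong-≗ (λ j → cong (λ b → if b then p j else q j) (S≗S′ j))

stableWeight-extensional : ∀ {n} (G : Graph n) p q → Extensional (stableWeight G p q)
stableWeight-extensional G p q S S′ S≗S′ =
  cong₂ (λ b w → 𝟙 b * w) (isStable-extensional G S S′ S≗S′) (weight-extensional p q S S′ S≗S′)

Z-cong : ∀ {n} (G : Graph n) {p p′ q q′ : Fin n → ℕ} → (∀ i → p i ≡ p′ i) → (∀ i → q i ≡ q′ i) → Z G p q ≡ Z G p′ q′
Z-cong {n} G p≗p′ q≗q′ = sumSubsets-cong n (λ S → cong (𝟙 (isStable G S) *_) (Mul.sum-cong-≗ (λ j → choose (S j) j)))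
  where
    choose : ∀ b j → (if b then _ else _) ≡ (if b then _ else _)
    choose true  j = p≗p′ j
    choose false j = q≗q′ j

Z-mono : ∀ {n} (G : Graph n) {p p′ q q′ : Fin n → ℕ} → (∀ i → p i ≤ p′ i) → (∀ i → q i ≤ q′ i) → Z G p q ≤ Z G p′ q′
Z-mono {n} G p≤p′ q≤q′ = sumSubsets-mono n (λ S → *-monoʳ-≤ (𝟙 (isStable G S)) (∏-mono n (λ j → choose (S j) j)))
  where
    choose : ∀ b j → (if b then _ else _) ≤ (if b then _ else _)
    choose true  j = p≤p′ j
    choose false j = q≤q′ j

Z-positive : ∀ {n} (G : Graph n) p q → (∀ i → 0 < q i) → 0 < Z G p q
Z-positive {n} G p q q>0 = begin-strict
  0                                      <⟨ ∏-positive n q q>0 ⟩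
  ∏ n q                                  ≡⟨ sym (*-identityˡ _) ⟩
  1 * weight p q (λ _ → false)           ≡⟨ cong (λ b → 𝟙 b * weight p q (λ _ → false)) (Stable⇒isStable G (λ _ → false) (λ _ _ ())) ⟨
  stableWeight G p q (λ _ → false)       ≤⟨ sumSubsets-≥-empty n _ (stableWeight-extensional G p q) ⟩
  Z G p q                                ∎
  where open ≤-Reasoning

one : ∀ {n} → Fin n → ℕ
one _ = 1

F≡Z-one : ∀ {n} (G : Graph n) → F G ≡ Z G one one
F≡Z-one {n} G = trans (countSubsets≡sum n (isStable G) (isStable-extensional G))
                      (sumSubsets-cong n (λ S → sym (trans (cong (𝟙 (isStable G S) *_) (weight-one n S)) (*-identityʳ _))))
  where
    countSubsets≡sum : ∀ n (P : Subset n → Bool) → Extensional P → countSubsets n P ≡ sumSubsets n (λ S → 𝟙 (P S))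
    countSubsets≡sum zero    P ext = cong 𝟙 (ext _ _ (λ ()))
    countSubsets≡sum (suc n) P ext = cong₂ _+_
      (countSubsets≡sum n (λ S → P (consB false S)) (Extensional-consB ext false))
      (countSubsets≡sum n (λ S → P (consB true S)) (Extensional-consB ext true))
    weight-one : ∀ n (S : Subset n) → weight one one S ≡ 1
    weight-one zero    S = refl
    weight-one (suc n) S with S zero
    ... | true  = trans (+-identityʳ _) (weight-one n (S ∘ suc))
    ... | false = trans (+-identityʳ _) (weight-one n (S ∘ suc))

update : ∀ {n} → (Fin n → ℕ) → Fin n → ℕ → Fin n → ℕ
update f u c x = if ⌊ x ≟ u ⌋ then c else f x

update-same : ∀ {n} (f : Fin n → ℕ) u c → update f u c u ≡ c
update-same f u c with u ≟ u
... | yes _   = refl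
... | no u≢u = ⊥-elim (u≢u refl)

update-other : ∀ {n} (f : Fin n → ℕ) u c x → x ≢ u → update f u c x ≡ f x
update-other f u c x x≢u with x ≟ u
... | yes x≡u = ⊥-elim (x≢u x≡u)
... | no _    = refl

update-self : ∀ {n} (f : Fin n → ℕ) u x → update f u (f u) x ≡ f x
update-self f u x with x ≟ u
... | yes refl = refl
... | no _     = refl

update-update : ∀ {n} (f : Fin n → ℕ) u a b x → update (update f u a) u b x ≡ update f u b x
update-update f u a b x with x ≟ u
... | yes _ = refl
... | no _  = refl

update-comm : ∀ {n} (f : Fin n → ℕ) u w a b → u ≢ w → ∀ x → update (update f u a) w b x ≡ update (update f w b) u a x
update-comm f u w a b u≢w x with x ≟ u | x ≟ w
... | yes refl | yes refl = ⊥-elim (u≢w refl)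
... | yes refl | no _     = refl
... | no _     | yes refl = refl
... | no _     | no _     = refl

update-0-≤ : ∀ {n} (f : Fin n → ℕ) u x → update f u 0 x ≤ f x
update-0-≤ f u x with x ≟ u
... | yes _ = z≤n
... | no _  = ≤-refl

update-reindex : ∀ {m n} (g : Fin m → Fin n) → (∀ a b → g a ≡ g b → a ≡ b) → ∀ (f : Fin n → ℕ) u c x →
                 update f (g u) c (g x) ≡ update (f ∘ g) u c x
update-reindex g g-inj f u c x with g x ≟ g u | x ≟ u
... | yes _        | yes _    = refl
... | yes gx≡gu    | no x≢u   = ⊥-elim (x≢u (g-inj _ _ gx≡gu))
... | no gx≢gu     | yes refl = ⊥-elim (gx≢gu refl)
... | no _         | no _     = refl

weight-update-insertAt : ∀ {n} (p q : Fin (suc n) → ℕ) u a b (S : Subset n) c →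
                         weight (update p u a) (update q u b) (insertAt S u c)
                           ≡ (if c then a else b) * weight (p ∘ punchIn u) (q ∘ punchIn u) S
weight-update-insertAt {n} p q u a b S c =
  trans (Mul.sum-remove {i = u} (λ j → if insertAt S u c j then update p u a j else update q u b j))
        (cong₂ _*_ (at-u c (insertAt-lookup S u c)) (Mul.sum-cong-≗ (λ j → away-from-u (S j) j (insertAt-punchIn S u c j))))
  where
    at-u : ∀ s → insertAt S u c u ≡ s →
           (if insertAt S u c u then update p u a u else update q u b u) ≡ (if s then a else b)
    at-u true  eq rewrite eq = update-same p u a
    at-u false eq rewrite eq = update-same q u b
    away-from-u : ∀ s j → insertAt S u c (punchIn u j) ≡ s →
                  (if insertAt S u c (punchIn u j) then update p u a (punchIn u j) else update q u b (punchIn u j))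
                    ≡ (if s then p (punchIn u j) else q (punchIn u j))
    away-from-u true  j eq rewrite eq = update-other p u a _ (punchInᵢ≢i u j)
    away-from-u false j eq rewrite eq = update-other q u b _ (punchInᵢ≢i u j)

Zfixed : ∀ {n} → Graph (suc n) → Fin (suc n) → Bool → (Fin (suc n) → ℕ) → (Fin (suc n) → ℕ) → ℕ
Zfixed {n} G u c p q = sumSubsets n (λ S → 𝟙 (isStable G (insertAt S u c)) * weight (p ∘ punchIn u) (q ∘ punchIn u) S)

Z-update : ∀ {n} (G : Graph (suc n)) u p q a b →
           Z G (update p u a) (update q u b) ≡ b * Zfixed G u false p q + a * Zfixed G u true p q
Z-update {n} G u p q a b =
  trans (sumSubsets-insertAt n u (stableWeight G (update p u a) (update q u b)) (stableWeight-extensional G (update p u a) (update q u b)))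
        (cong₂ _+_ (pull false) (pull true))
  where
    pull : ∀ c → sumSubsets n (λ S → stableWeight G (update p u a) (update q u b) (insertAt S u c))
                   ≡ (if c then a else b) * Zfixed G u c p q
    pull c = trans (sumSubsets-cong n (λ S → trans (cong (𝟙 (isStable G (insertAt S u c)) *_)
                                                         (weight-update-insertAt p q u a b S c))
                                                   (*-left-comm (𝟙 (isStable G (insertAt S u c))) (if c then a else b) _)))
                   (sumSubsets-*ˡ n (if c then a else b) (λ S → 𝟙 (isStable G (insertAt S u c)) * weight (p ∘ punchIn u) (q ∘ punchIn u) S))

Zin Zout : ∀ {n} → Graph n → Fin n → (Fin n → ℕ) → (Fin n → ℕ) → ℕ
Zin  G u p q = Z G (update p u 1) (update q u 0)
Zout G u p q = Z G (update p u 0) (update q u 1)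

Zin≡Zfixed : ∀ {n} (G : Graph (suc n)) u p q → Zin G u p q ≡ Zfixed G u true p q
Zin≡Zfixed G u p q = trans (Z-update G u p q 1 0) (+-identityʳ _)

Zout≡Zfixed : ∀ {n} (G : Graph (suc n)) u p q → Zout G u p q ≡ Zfixed G u false p q
Zout≡Zfixed G u p q = trans (Z-update G u p q 0 1) (trans (+-identityʳ _) (+-identityʳ _))

Z-linear : ∀ {n} (G : Graph n) u p q a b → Z G (update p u a) (update q u b) ≡ a * Zin G u p q + b * Zout G u p q
Z-linear {suc n} G u p q a b rewrite Z-update G u p q a b | Zin≡Zfixed G u p q | Zout≡Zfixed G u p q =
  +-comm (b * Zfixed G u false p q) _

Z-split : ∀ {n} (G : Graph n) u p q → Z G p q ≡ p u * Zin G u p q + q u * Zout G u p q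
Z-split G u p q =
  trans (Z-cong G {p} {update p u (p u)} {q} {update q u (q u)} (λ i → sym (update-self p u i)) (λ i → sym (update-self q u i)))
        (Z-linear G u p q (p u) (q u))

Z-forbid : ∀ {n} (G : Graph n) u p q → Z G (update p u 0) q ≡ q u * Zout G u p q
Z-forbid G u p q =
  trans (Z-cong G {update p u 0} {update p u 0} {q} {update q u (q u)} (λ _ → refl) (λ i → sym (update-self q u i)))
        (Z-linear G u p q 0 (q u))

isStable-insertAt-false : ∀ {n} (G : Graph (suc n)) u S → isStable G (insertAt S u false) ≡ isStable (removeVertex G u) S
isStable-insertAt-false G u S = isStable-≡ G (removeVertex G u) (insertAt S u false) S
  (λ st x y x∈S y∈S → st (punchIn u x) (punchIn u y) (trans (insertAt-punchIn S u false x) x∈S)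
                                                        (trans (insertAt-punchIn S u false y) y∈S))
  (λ st x y x∈S y∈S → trans (cong₂ G (sym (punchIn-punchOut (≢u x x∈S))) (sym (punchIn-punchOut (≢u y y∈S))))
                            (st _ _ (inside x x∈S) (inside y y∈S)))
  where
    ≢u : ∀ x → insertAt S u false x ≡ true → u ≢ x
    ≢u x x∈S refl with () ← trans (sym (insertAt-lookup S u false)) x∈S
    inside : ∀ x (x∈S : insertAt S u false x ≡ true) → S (punchOut (≢u x x∈S)) ≡ true
    inside x x∈S = trans (sym (insertAt-punchIn S u false _)) (trans (cong (insertAt S u false) (punchIn-punchOut (≢u x x∈S))) x∈S)

isStable-insertAt-isolated : ∀ {n} (G : Graph (suc n)) u → (∀ y → G u y ≡ false) → (∀ y → G y u ≡ false) →
                             ∀ S → isStable G (insertAt S u true) ≡ isStable G (insertAt S u false)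
isStable-insertAt-isolated G u no-out no-in S = isStable-≡ G G (insertAt S u true) (insertAt S u false)
  (λ st x y x∈S y∈S → st x y (grow x x∈S) (grow y y∈S))
  shrink
  where
    irrelevant : ∀ b b′ x → x ≢ u → insertAt S u b x ≡ insertAt S u b′ x
    irrelevant b b′ x x≢u = begin
      insertAt S u b x                 ≡⟨ cong (insertAt S u b) (punchIn-punchOut (x≢u ∘ sym)) ⟨
      insertAt S u b (punchIn u x′)    ≡⟨ insertAt-punchIn S u b x′ ⟩
      S x′                             ≡⟨ insertAt-punchIn S u b′ x′ ⟨
      insertAt S u b′ (punchIn u x′)   ≡⟨ cong (insertAt S u b′) (punchIn-punchOut (x≢u ∘ sym)) ⟩
      insertAt S u b′ x                ∎
      where
        open ≡-Reasoning
        x′ = punchOut (x≢u ∘ sym)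
    grow : ∀ x → insertAt S u false x ≡ true → insertAt S u true x ≡ true
    grow x x∈S with x ≟ u
    ... | yes refl = insertAt-lookup S u true
    ... | no x≢u   = trans (irrelevant true false x x≢u) x∈S
    shrink : Stable G (insertAt S u false) → Stable G (insertAt S u true)
    shrink st x y x∈S y∈S with x ≟ u | y ≟ u
    ... | yes refl | _        = no-out y
    ... | no _     | yes refl = no-in x
    ... | no x≢u   | no y≢u   = st x y (trans (irrelevant false true x x≢u) x∈S) (trans (irrelevant false true y y≢u) y∈S)

Zout≡Z-removeVertex : ∀ {n} (G : Graph (suc n)) u p q → Zout G u p q ≡ Z (removeVertex G u) (p ∘ punchIn u) (q ∘ punchIn u)
Zout≡Z-removeVertex {n} G u p q = trans (Zout≡Zfixed G u p q)
  (sumSubsets-cong n (λ S → cong (λ b → 𝟙 b * weight (p ∘ punchIn u) (q ∘ punchIn u) S) (isStable-insertAt-false G u S)))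

Zin≡Zout-isolated : ∀ {n} (G : Graph n) u → (∀ y → G u y ≡ false) → (∀ y → G y u ≡ false) →
                    ∀ p q → Zin G u p q ≡ Zout G u p q
Zin≡Zout-isolated {suc n} G u no-out no-in p q = begin
  Zin G u p q             ≡⟨ Zin≡Zfixed G u p q ⟩
  Zfixed G u true p q     ≡⟨ sumSubsets-cong n (λ S → cong (λ b → 𝟙 b * weight (p ∘ punchIn u) (q ∘ punchIn u) S)
                                                          (isStable-insertAt-isolated G u no-out no-in S)) ⟩
  Zfixed G u false p q    ≡⟨ Zout≡Zfixed G u p q ⟨
  Zout G u p q            ∎
  where open ≡-Reasoning

-- Adding a vertex, disjoint unions and relabelling

mask : ∀ {n} → (Fin n → Bool) → (Fin n → ℕ) → Fin n → ℕ
mask A p y = if A y then 0 else p y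

mask-≤ : ∀ {n} (A : Fin n → Bool) p i → mask A p i ≤ p i
mask-≤ A p i with A i
... | true  = z≤n
... | false = ≤-refl

avoids : ∀ {n} → (Fin n → Bool) → Subset n → Bool
avoids {n} A S = allB n (λ y → not (S y ∧ A y))

weight-mask : ∀ n (A : Fin n → Bool) p q S → weight (mask A p) q S ≡ 𝟙 (avoids A S) * weight p q S
weight-mask zero    A p q S = refl
weight-mask (suc n) A p q S with S zero | A zero
... | true  | true  = refl
... | true  | false = trans (cong (p zero *_) (weight-mask n (A ∘ suc) (p ∘ suc) (q ∘ suc) (S ∘ suc)))
                            (*-left-comm (p zero) (𝟙 (avoids (A ∘ suc) (S ∘ suc))) _)
... | false | _     = trans (cong (q zero *_) (weight-mask n (A ∘ suc) (p ∘ suc) (q ∘ suc) (S ∘ suc)))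
                            (*-left-comm (q zero) (𝟙 (avoids (A ∘ suc) (S ∘ suc))) _)

isStable-addVertex-out : ∀ {n} (A : Fin n → Bool) G S → isStable (addVertex A G) (consB false S) ≡ isStable G S
isStable-addVertex-out A G S =
  isStable-≡ (addVertex A G) G (consB false S) S (λ st x y → st (suc x) (suc y)) extend
  where
    extend : Stable G S → Stable (addVertex A G) (consB false S)
    extend st (suc x) (suc y) x∈S y∈S = st x y x∈S y∈S

isStable-addVertex-in : ∀ {n} (A : Fin n → Bool) G S → isStable (addVertex A G) (consB true S) ≡ (isStable G S ∧ avoids A S)
isStable-addVertex-in {n} A G S = true⇔true⇒≡ restrict extend
  where
    restrict : isStable (addVertex A G) (consB true S) ≡ true → (isStable G S ∧ avoids A S) ≡ true
    restrict stable = ⇒∧ (Stable⇒isStable G S (λ x y → st (suc x) (suc y))) (⇒allB n avoided)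
      where
        st = isStable⇒Stable (addVertex A G) (consB true S) stable
        avoided : ∀ y → not (S y ∧ A y) ≡ true
        avoided y with S y in y∈S
        ... | false = refl
        ... | true  = cong not (st zero (suc y) refl y∈S)
    extend : (isStable G S ∧ avoids A S) ≡ true → isStable (addVertex A G) (consB true S) ≡ true
    extend both = Stable⇒isStable (addVertex A G) (consB true S) st
      where
        unmarked : ∀ y → S y ≡ true → A y ≡ false
        unmarked y y∈S = marked-out (S y) (A y) y∈S (allB⇒ n {λ y → not (S y ∧ A y)} (proj₂ (∧⇒ both)) y)
          where
            marked-out : ∀ s a → s ≡ true → not (s ∧ a) ≡ true → a ≡ false
            marked-out true false _ _ = refl
        st : Stable (addVertex A G) (consB true S)
        st zero    zero    _   _   = refl
        st zero    (suc y) _   y∈S = unmarked y y∈S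
        st (suc x) zero    x∈S _   = unmarked x x∈S
        st (suc x) (suc y) x∈S y∈S = isStable⇒Stable G S (proj₁ (∧⇒ both)) x y x∈S y∈S

Z-addVertex : ∀ {n} (A : Fin n → Bool) (G : Graph n) p q →
              Z (addVertex A G) p q ≡ q zero * Z G (p ∘ suc) (q ∘ suc) + p zero * Z G (mask A (p ∘ suc)) (q ∘ suc)
Z-addVertex {n} A G p q = cong₂ _+_
  (trans (sumSubsets-cong n out) (sumSubsets-*ˡ n (q zero) (stableWeight G (p ∘ suc) (q ∘ suc))))
  (trans (sumSubsets-cong n in′) (sumSubsets-*ˡ n (p zero) (stableWeight G (mask A (p ∘ suc)) (q ∘ suc))))
  where
    out : ∀ S → stableWeight (addVertex A G) p q (consB false S) ≡ q zero * stableWeight G (p ∘ suc) (q ∘ suc) S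
    out S rewrite isStable-addVertex-out A G S = *-left-comm (𝟙 (isStable G S)) (q zero) _
    rearrange : ∀ a b c d → (a * b) * (c * d) ≡ c * (a * (b * d))
    rearrange = solve-∀
    in′ : ∀ S → stableWeight (addVertex A G) p q (consB true S) ≡ p zero * stableWeight G (mask A (p ∘ suc)) (q ∘ suc) S
    in′ S rewrite isStable-addVertex-in A G S | 𝟙-∧ (isStable G S) (avoids A S) | weight-mask n A (p ∘ suc) (q ∘ suc) S =
      rearrange (𝟙 (isStable G S)) (𝟙 (avoids A S)) (p zero) (weight (p ∘ suc) (q ∘ suc) S)

disjointUnion-↑ˡ-↑ˡ : ∀ {m n} (T : Graph m) (G : Graph n) i j → disjointUnion T G (i ↑ˡ n) (j ↑ˡ n) ≡ T i j
disjointUnion-↑ˡ-↑ˡ {m} {n} T G i j rewrite splitAt-↑ˡ m i n | splitAt-↑ˡ m j n = refl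

disjointUnion-↑ʳ-↑ʳ : ∀ {m n} (T : Graph m) (G : Graph n) i j → disjointUnion T G (m ↑ʳ i) (m ↑ʳ j) ≡ G i j
disjointUnion-↑ʳ-↑ʳ {m} {n} T G i j rewrite splitAt-↑ʳ m n i | splitAt-↑ʳ m n j = refl

disjointUnion-↑ˡ-↑ʳ : ∀ {m n} (T : Graph m) (G : Graph n) i j → disjointUnion T G (i ↑ˡ n) (m ↑ʳ j) ≡ false
disjointUnion-↑ˡ-↑ʳ {m} {n} T G i j rewrite splitAt-↑ˡ m i n | splitAt-↑ʳ m n j = refl

disjointUnion-↑ʳ-↑ˡ : ∀ {m n} (T : Graph m) (G : Graph n) i j → disjointUnion T G (m ↑ʳ i) (j ↑ˡ n) ≡ false
disjointUnion-↑ʳ-↑ˡ {m} {n} T G i j rewrite splitAt-↑ʳ m n i | splitAt-↑ˡ m j n = refl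

weight-++ : ∀ {m n} (p q : Fin (m + n) → ℕ) A B →
            weight p q (A ++ B) ≡ weight (λ i → p (i ↑ˡ n)) (λ i → q (i ↑ˡ n)) A * weight (λ j → p (m ↑ʳ j)) (λ j → q (m ↑ʳ j)) B
weight-++ {m} {n} p q A B = trans (∏-↑ m n _)
  (cong₂ _*_ (Mul.sum-cong-≗ (λ i → cong (λ b → if b then p (i ↑ˡ n) else q (i ↑ˡ n)) (lookup-++ˡ A B i)))
             (Mul.sum-cong-≗ (λ j → cong (λ b → if b then p (m ↑ʳ j) else q (m ↑ʳ j)) (lookup-++ʳ A B j))))

isStable-disjointUnion : ∀ {m n} (T : Graph m) (G : Graph n) A B →
                         isStable (disjointUnion T G) (A ++ B) ≡ (isStable T A ∧ isStable G B)
isStable-disjointUnion {m} {n} T G A B = true⇔true⇒≡ restrict extend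
  where
    restrict : isStable (disjointUnion T G) (A ++ B) ≡ true → (isStable T A ∧ isStable G B) ≡ true
    restrict stable = ⇒∧
      (Stable⇒isStable T A (λ x y x∈A y∈A → trans (sym (disjointUnion-↑ˡ-↑ˡ T G x y))
        (st (x ↑ˡ n) (y ↑ˡ n) (trans (lookup-++ˡ A B x) x∈A) (trans (lookup-++ˡ A B y) y∈A))))
      (Stable⇒isStable G B (λ x y x∈B y∈B → trans (sym (disjointUnion-↑ʳ-↑ʳ T G x y))
        (st (m ↑ʳ x) (m ↑ʳ y) (trans (lookup-++ʳ A B x) x∈B) (trans (lookup-++ʳ A B y) y∈B))))
      where st = isStable⇒Stable (disjointUnion T G) (A ++ B) stable
    componentwise : Stable T A → Stable G B → ∀ (u v : Fin m ⊎ Fin n) →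
                    [ A , B ]′ u ≡ true → [ A , B ]′ v ≡ true → duAdj T G u v ≡ false
    componentwise stT stG (inj₁ a) (inj₁ b) = stT a b
    componentwise stT stG (inj₁ a) (inj₂ b) _ _ = refl
    componentwise stT stG (inj₂ a) (inj₁ b) _ _ = refl
    componentwise stT stG (inj₂ a) (inj₂ b) = stG a b
    extend : (isStable T A ∧ isStable G B) ≡ true → isStable (disjointUnion T G) (A ++ B) ≡ true
    extend both = Stable⇒isStable (disjointUnion T G) (A ++ B) (λ x y →
      componentwise (isStable⇒Stable T A (proj₁ (∧⇒ both))) (isStable⇒Stable G B (proj₂ (∧⇒ both))) (splitAt m x) (splitAt m y))

Z-disjointUnion : ∀ {m n} (T : Graph m) (G : Graph n) p q →
                  Z (disjointUnion T G) p q ≡ Z T (λ i → p (i ↑ˡ n)) (λ i → q (i ↑ˡ n)) * Z G (λ j → p (m ↑ʳ j)) (λ j → q (m ↑ʳ j))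
Z-disjointUnion {m} {n} T G p q =
  trans (sumSubsets-++ m n _ (stableWeight-extensional _ p q))
  (trans (sumSubsets-cong m (λ A → trans (sumSubsets-cong n (factor A)) (sumSubsets-*ˡ n (wT A) wG)))
         (sumSubsets-*ʳ m (Z G pG qG) wT))
  where
    pT = λ i → p (i ↑ˡ n)
    qT = λ i → q (i ↑ˡ n)
    pG = λ j → p (m ↑ʳ j)
    qG = λ j → q (m ↑ʳ j)
    wT = stableWeight T pT qT
    wG = stableWeight G pG qG
    rearrange : ∀ a b c d → (a * b) * (c * d) ≡ (a * c) * (b * d)
    rearrange = solve-∀
    factor : ∀ A B → stableWeight (disjointUnion T G) p q (A ++ B) ≡ wT A * wG B
    factor A B rewrite isStable-disjointUnion T G A B | 𝟙-∧ (isStable T A) (isStable G B) | weight-++ p q A B =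
      rearrange (𝟙 (isStable T A)) (𝟙 (isStable G B)) (weight pT qT A) (weight pG qG B)

Relabelling : ∀ {n} → Graph n → Graph n → Permutation′ n → Set
Relabelling G H σ = ∀ x y → H x y ≡ G (σ ⟨$⟩ʳ x) (σ ⟨$⟩ʳ y)

Z-relabel : ∀ {n} (G H : Graph n) (σ : Permutation′ n) → Relabelling G H σ →
            ∀ p q → Z H p q ≡ Z G (λ y → p (σ ⟨$⟩ˡ y)) (λ y → q (σ ⟨$⟩ˡ y))
Z-relabel {n} G H σ H≅G p q =
  sym (trans (sym (sumSubsets-permute n (flip σ) _ (stableWeight-extensional G _ _))) (sumSubsets-cong n relabelled))
  where
    relabelled : ∀ S → stableWeight G (λ y → p (σ ⟨$⟩ˡ y)) (λ y → q (σ ⟨$⟩ˡ y)) (λ x → S (σ ⟨$⟩ˡ x)) ≡ stableWeight H p q S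
    relabelled S = cong₂ (λ b w → 𝟙 b * w)
      (isStable-≡ G H (λ x → S (σ ⟨$⟩ˡ x)) S
        (λ st x y x∈S y∈S → trans (H≅G x y)
          (st (σ ⟨$⟩ʳ x) (σ ⟨$⟩ʳ y) (trans (cong S (inverseˡ σ)) x∈S) (trans (cong S (inverseˡ σ)) y∈S)))
        (λ st a b a∈S b∈S → trans (cong₂ G (sym (inverseʳ σ)) (sym (inverseʳ σ)))
          (trans (sym (H≅G (σ ⟨$⟩ˡ a) (σ ⟨$⟩ˡ b))) (st (σ ⟨$⟩ˡ a) (σ ⟨$⟩ˡ b) a∈S b∈S))))
      (sym (Mul.sum-permute (λ x → if S x then p x else q x) (flip σ)))

degree-relabel : ∀ {n} (G H : Graph n) (σ : Permutation′ n) → Relabelling G H σ → ∀ x → degree H x ≡ degree G (σ ⟨$⟩ʳ x)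
degree-relabel {n} G H σ H≅G x = trans (countFin-cong n (H≅G x)) (countFin-permute n σ (G (σ ⟨$⟩ʳ x)))

degree-disjointUnion-↑ˡ : ∀ {m n} (T : Graph m) (G : Graph n) i → degree (disjointUnion T G) (i ↑ˡ n) ≡ degree T i
degree-disjointUnion-↑ˡ {m} {n} T G i = trans (countFin-↑ m n _)
  (trans (cong₂ _+_ (countFin-cong m (disjointUnion-↑ˡ-↑ˡ T G i))
                    (trans (countFin-cong n (disjointUnion-↑ˡ-↑ʳ T G i)) (countFin-false n)))
         (+-identityʳ _))

degree-disjointUnion-↑ʳ : ∀ {m n} (T : Graph m) (G : Graph n) i → degree (disjointUnion T G) (m ↑ʳ i) ≡ degree G i
degree-disjointUnion-↑ʳ {m} {n} T G i = trans (countFin-↑ m n _)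
  (cong₂ _+_ (trans (countFin-cong m (disjointUnion-↑ʳ-↑ˡ T G i)) (countFin-false m))
             (countFin-cong n (disjointUnion-↑ʳ-↑ʳ T G i)))

-- Comparisons with φ

-- a <φ· b means a < φ b: for x = a / b this is x² < x + 1.
_<φ·_ : ℕ → ℕ → Set
a <φ· b = a * a < a * b + b * b

n<φ·n : ∀ n → 0 < n → n <φ· n
n<φ·n (suc n) _ = m<m+n _ (s≤s z≤n)

+-square-identity : ∀ x y → (x + y) * (x + y) + x * x ≡ ((x + y) * x + x * x) + (x * y + y * y)
+-square-identity = solve-∀

-- Both directions come from 1 + 1/φ = φ.
<φ·⇒+>φ· : ∀ x y → x <φ· y → (x + y) >φ· x
<φ·⇒+>φ· x y x<φy = +-cancelʳ-< _ _ _ (begin-strict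
  ((x + y) * x + x * x) + x * x            <⟨ +-monoʳ-< ((x + y) * x + x * x) x<φy ⟩
  ((x + y) * x + x * x) + (x * y + y * y)  ≡⟨ +-square-identity x y ⟨
  (x + y) * (x + y) + x * x                ∎)
  where open ≤-Reasoning

>φ·⇒+<φ· : ∀ x y → x >φ· y → (x + y) <φ· x
>φ·⇒+<φ· x y x>φy = +-cancelʳ-< _ _ _ (begin-strict
  (x + y) * (x + y) + x * x                ≡⟨ +-square-identity x y ⟩
  ((x + y) * x + x * x) + (x * y + y * y)  <⟨ +-monoʳ-< ((x + y) * x + x * x) x>φy ⟩
  ((x + y) * x + x * x) + x * x            ∎)
  where open ≤-Reasoning

square-nonZero : ∀ c → 0 < c → NonZero (c * c)
square-nonZero (suc c) _ = _

*-mono->φ· : ∀ a b c d → a >φ· b → d ≤ c → 0 < c → (a * c) >φ· (b * d)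
*-mono->φ· a b c d a>φb d≤c c>0 = begin-strict
  (a * c) * (b * d) + (b * d) * (b * d)  ≤⟨ +-mono-≤ (*-monoʳ-≤ (a * c) bd≤bc) (*-mono-≤ bd≤bc bd≤bc) ⟩
  (a * c) * (b * c) + (b * c) * (b * c)  ≡⟨ factor a b c ⟩
  (a * b + b * b) * (c * c)              <⟨ *-monoˡ-< (c * c) {{square-nonZero c c>0}} a>φb ⟩
  (a * a) * (c * c)                      ≡⟨ square-* a c ⟩
  (a * c) * (a * c)                      ∎
  where
    open ≤-Reasoning
    bd≤bc = *-monoʳ-≤ b d≤c
    factor : ∀ a b c → (a * c) * (b * c) + (b * c) * (b * c) ≡ (a * b + b * b) * (c * c)
    factor = solve-∀
    square-* : ∀ a c → (a * a) * (c * c) ≡ (a * c) * (a * c)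
    square-* = solve-∀

*-mono->φ·ʳ : ∀ a b c d → c >φ· d → b ≤ a → 0 < a → (a * c) >φ· (b * d)
*-mono->φ·ʳ a b c d c>φd b≤a a>0 = subst₂ _>φ·_ (*-comm c a) (*-comm d b) (*-mono->φ· c d a b c>φd b≤a a>0)

*-mono-<φ· : ∀ a b c d → a <φ· b → c ≤ d → 0 < c → (a * c) <φ· (b * d)
*-mono-<φ· a b c d a<φb c≤d c>0 = begin-strict
  (a * c) * (a * c)                      ≡⟨ square-* a c ⟩
  (a * a) * (c * c)                      <⟨ *-monoˡ-< (c * c) {{square-nonZero c c>0}} a<φb ⟩
  (a * b + b * b) * (c * c)              ≡⟨ factor a b c ⟩
  (a * c) * (b * c) + (b * c) * (b * c)  ≤⟨ +-mono-≤ (*-monoʳ-≤ (a * c) bc≤bd) (*-mono-≤ bc≤bd bc≤bd) ⟩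
  (a * c) * (b * d) + (b * d) * (b * d)  ∎
  where
    open ≤-Reasoning
    bc≤bd = *-monoʳ-≤ b c≤d
    factor : ∀ a b c → (a * b + b * b) * (c * c) ≡ (a * c) * (b * c) + (b * c) * (b * c)
    factor = solve-∀
    square-* : ∀ a c → (a * c) * (a * c) ≡ (a * a) * (c * c)
    square-* = solve-∀

-- Trees of stars: the leaf bound

Marking : ℕ → Set
Marking n = Fin n → Bool

-- By computation GluedLeaf G unmarked y is IsLeaf G y, and mask (markedAt v) p is update p v 0.
unmarked : ∀ {n} → Marking n
unmarked _ = false

markedAt : ∀ {n} → Fin n → Marking n
markedAt v y = ⌊ y ≟ v ⌋

markedAt-self : ∀ {n} (v : Fin n) → markedAt v v ≡ true
markedAt-self v with v ≟ v
... | yes _   = refl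
... | no v≢v = ⊥-elim (v≢v refl)

-- Z of addVertex A G with the new vertex weighted Y inside and X outside the stable set (cf. Z-addVertex).
Zglued : ∀ {n} → Graph n → Marking n → (Fin n → ℕ) → (Fin n → ℕ) → ℕ → ℕ → ℕ
Zglued G A p q X Y = Z G p q * X + Z G (mask A p) q * Y

Zglued-cong : ∀ {n} (G : Graph n) A {p p′ q q′ : Fin n → ℕ} → (∀ i → p i ≡ p′ i) → (∀ i → q i ≡ q′ i) →
              ∀ X Y → Zglued G A p q X Y ≡ Zglued G A p′ q′ X Y
Zglued-cong G A p≗p′ q≗q′ X Y =
  cong₂ (λ a b → a * X + b * Y) (Z-cong G p≗p′ q≗q′) (Z-cong G (λ i → cong (λ c → if A i then 0 else c) (p≗p′ i)) q≗q′)

Zglued-addVertex : ∀ {n} (A : Marking n) (G : Graph n) p q → p zero ≡ 1 → q zero ≡ 1 →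
                   Z (addVertex A G) p q ≡ Zglued G A (p ∘ suc) (q ∘ suc) 1 1
Zglued-addVertex A G p q p₀≡1 q₀≡1 rewrite Z-addVertex A G p q | p₀≡1 | q₀≡1 =
  swap (Z G (p ∘ suc) (q ∘ suc)) (Z G (mask A (p ∘ suc)) (q ∘ suc))
  where
    swap : ∀ a b → 1 * a + 1 * b ≡ a * 1 + b * 1
    swap = solve-∀

-- y is a leaf of addVertex A G.
GluedLeaf : ∀ {n} → Graph n → Marking n → Fin n → Set
GluedLeaf G A y = 𝟙 (A y) + degree G y ≤ 1

GluedLeaf-markedAt-self : ∀ {n} (T : Graph n) v → GluedLeaf T (markedAt v) v → degree T v ≡ 0
GluedLeaf-markedAt-self T v leaf rewrite markedAt-self v = n≤0⇒n≡0 (≤-pred leaf)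

degree≡0⇒GluedLeaf-markedAt-self : ∀ {n} (T : Graph n) v → degree T v ≡ 0 → GluedLeaf T (markedAt v) v
degree≡0⇒GluedLeaf-markedAt-self T v deg≡0 rewrite markedAt-self v = s≤s (≤-reflexive deg≡0)

-- The weight (p, q) of a leaf stands for a pendant subtree, whose q / p is below φ by the invariant itself.
LeafWeight : ℕ → ℕ → Set
LeafWeight a b = 0 < a × 0 < b × b <φ· a

Admissible : Set → ℕ → ℕ → Set
Admissible L a b = (L → LeafWeight a b) × (¬ L → a ≡ 1 × b ≡ 1)

Admissible⇒out-positive : ∀ {L a b} → Dec L → Admissible L a b → 0 < b
Admissible⇒out-positive (yes l)  (leaf , _)     = proj₁ (proj₂ (leaf l))
Admissible⇒out-positive (no ¬l) (_ , inner) rewrite proj₂ (inner ¬l) = s≤s z≤n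

AdmissibleAt : ∀ {n} → Graph n → Marking n → (Fin n → ℕ) → (Fin n → ℕ) → Fin n → Set
AdmissibleAt G A p q y = Admissible (GluedLeaf G A y) (p y) (q y)

AdmissibleAt⇒out-positive : ∀ {n} (G : Graph n) A p q y → AdmissibleAt G A p q y → 0 < q y
AdmissibleAt⇒out-positive G A p q y = Admissible⇒out-positive (𝟙 (A y) + degree G y ≤? 1)

AdmissibleAt-markedAt : ∀ {n} (T : Graph n) v p q y → y ≢ v → AdmissibleAt T (markedAt v) p q y → AdmissibleAt T unmarked p q y
AdmissibleAt-markedAt T v p q y y≢v adm with y ≟ v
... | yes y≡v = ⊥-elim (y≢v y≡v)
... | no _    = adm

out-positive : ∀ {n} (G : Graph n) A p q x → 0 < q x → (∀ y → y ≢ x → AdmissibleAt G A p q y) → ∀ y → 0 < q y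
out-positive G A p q x qx>0 adm y with y ≟ x
... | yes refl = qx>0
... | no y≢x   = AdmissibleAt⇒out-positive G A p q y (adm y y≢x)

Zout-positive : ∀ {n} (G : Graph n) A v p q → (∀ y → y ≢ v → AdmissibleAt G A p q y) → 0 < Zout G v p q
Zout-positive G A v p q adm = Z-positive G (update p v 0) (update q v 1) (out-positive G A (update p v 0) (update q v 1) v
  (subst (0 <_) (sym (update-same q v 1)) (s≤s z≤n))
  (λ y y≢v → subst₂ (Admissible (GluedLeaf G A y)) (sym (update-other p v 0 y y≢v)) (sym (update-other q v 1 y y≢v)) (adm y y≢v)))

Undirected : ∀ {n} → Graph n → Set
Undirected G = ∀ x y → G x y ≡ G y x

TrivialIfIsolated : ∀ {n} → Graph n → Set
TrivialIfIsolated G = ∀ x → degree G x ≡ 0 → ∀ y → y ≡ x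

LeafBound : ∀ {n} → Graph n → Set
LeafBound T = ∀ v → IsLeaf T v → ∀ p q → (∀ y → y ≢ v → AdmissibleAt T unmarked p q y) → Zout T v p q <φ· Zin T v p q

record TreeInvariant {n} (T : Graph n) : Set where
  field
    undirected        : Undirected T
    trivialIfIsolated : TrivialIfIsolated T
    leafBound         : LeafBound T

Zin≡Zout-degree0 : ∀ {n} (G : Graph n) → Undirected G → ∀ v → degree G v ≡ 0 → ∀ p q → Zin G v p q ≡ Zout G v p q
Zin≡Zout-degree0 {n} G undirected v deg≡0 p q =
  Zin≡Zout-isolated G v no-edge (λ y → trans (undirected y v) (no-edge y)) p q
  where
    no-edge : ∀ y → G v y ≡ false
    no-edge = countFin≡0 n (G v) deg≡0

Zout<φ·Zin⇒forbid->φ· : ∀ {n} (T : Graph n) v p q → p v ≡ 1 → q v ≡ 1 →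
                        Zout T v p q <φ· Zin T v p q → Z T p q >φ· Z T (update p v 0) q
Zout<φ·Zin⇒forbid->φ· T v p q pv≡1 qv≡1 Out<φ·In rewrite Z-split T v p q | Z-forbid T v p q | pv≡1 | qv≡1 =
  subst₂ _>φ·_ (rearrange (Zout T v p q) (Zin T v p q)) (sym (+-identityʳ _)) (<φ·⇒+>φ· (Zout T v p q) (Zin T v p q) Out<φ·In)
  where
    rearrange : ∀ a b → a + b ≡ (b + 0) + (a + 0)
    rearrange = solve-∀

-- An isolated v is a whole component on its own; otherwise its weight is (1, 1) and the leaf bound applies.
forbid->φ· : ∀ {n} (T : Graph n) → TreeInvariant T → (v : Fin n) → IsLeaf T v →
             ∀ p q → (∀ y → AdmissibleAt T (markedAt v) p q y) → Z T p q >φ· Z T (update p v 0) q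
forbid->φ· T inv v v-leaf p q adm with degree T v ≟ℕ 0
... | yes deg≡0 = subst₂ _>φ·_ (sym split) (sym (Z-forbid T v p q))
        (*-mono->φ· (p v + q v) (q v) Out Out (subst (_>φ· q v) (+-comm (q v) (p v)) (<φ·⇒+>φ· (q v) (p v) q<φp)) ≤-refl Out>0)
  where
    Out = Zout T v p q
    q<φp = proj₂ (proj₂ (proj₁ (adm v) (degree≡0⇒GluedLeaf-markedAt-self T v deg≡0)))
    Out>0 : 0 < Out
    Out>0 = Zout-positive T (markedAt v) v p q (λ y _ → adm y)
    split : Z T p q ≡ (p v + q v) * Out
    split = trans (Z-split T v p q)
              (trans (cong (λ z → p v * z + q v * Out) (Zin≡Zout-degree0 T (TreeInvariant.undirected inv) v deg≡0 p q))
                     (sym (*-distribʳ-+ Out (p v) (q v))))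
... | no deg≢0 = Zout<φ·Zin⇒forbid->φ· T v p q (proj₁ weight-one) (proj₂ weight-one)
      (TreeInvariant.leafBound inv v v-leaf p q (λ y y≢v → AdmissibleAt-markedAt T v p q y y≢v (adm y)))
  where
    weight-one : p v ≡ 1 × q v ≡ 1
    weight-one = proj₂ (adm v) (deg≢0 ∘ GluedLeaf-markedAt-self T v)

Zglued-markedAt : ∀ {n} (T : Graph n) v i p q X Y → i ≢ v → p v ≡ 1 → q v ≡ 1 → ∀ c d →
                  Zglued T (markedAt v) (update p i c) (update q i d) X Y
                    ≡ Z T (update (update p v X) i c) (update (update q v (X + Y)) i d)
Zglued-markedAt T v i p q X Y i≢v pv≡1 qv≡1 c d = begin
  Z T P Q * X + Z T (update P v 0) Q * Y                  ≡⟨ cong₂ (λ a b → a * X + b * Y) (Z-split T v P Q) (Z-forbid T v P Q) ⟩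
  (P v * In + Q v * Out) * X + Q v * Out * Y              ≡⟨ cong₂ (λ a b → (a * In + b * Out) * X + b * Out * Y) Pv≡1 Qv≡1 ⟩
  (1 * In + 1 * Out) * X + 1 * Out * Y                    ≡⟨ rearrange In Out X Y ⟩
  X * In + (X + Y) * Out                                  ≡⟨ Z-linear T v P Q X (X + Y) ⟨
  Z T (update P v X) (update Q v (X + Y))                 ≡⟨ Z-cong T (update-comm p i v c X i≢v) (update-comm q i v d (X + Y) i≢v) ⟩
  Z T (update (update p v X) i c) (update (update q v (X + Y)) i d) ∎
  where
    open ≡-Reasoning
    P = update p i c
    Q = update q i d
    In = Zin T v P Q
    Out = Zout T v P Q
    Pv≡1 : P v ≡ 1
    Pv≡1 = trans (update-other p i c v (i≢v ∘ sym)) pv≡1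
    Qv≡1 : Q v ≡ 1
    Qv≡1 = trans (update-other q i d v (i≢v ∘ sym)) qv≡1
    rearrange : ∀ a b X Y → (1 * a + 1 * b) * X + 1 * b * Y ≡ X * a + (X + Y) * b
    rearrange = solve-∀

Zglued-markedAt-isolated : ∀ {n} (T : Graph n) v p q X Y → Zin T v p q ≡ Zout T v p q → ∀ c d →
                           Zglued T (markedAt v) (update p v c) (update q v d) X Y ≡ ((c + d) * X + d * Y) * Zout T v p q
Zglued-markedAt-isolated T v p q X Y In≡Out c d = begin
  Z T (update p v c) (update q v d) * X + Z T (update (update p v c) v 0) (update q v d) * Y
    ≡⟨ cong₂ (λ a b → a * X + b * Y) (Z-linear T v p q c d)
             (trans (Z-cong T {q = update q v d} {q′ = update q v d} (update-update p v c 0) (λ _ → refl)) (Z-linear T v p q 0 d)) ⟩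
  (c * Zin T v p q + d * Out) * X + (0 * Zin T v p q + d * Out) * Y
    ≡⟨ cong (λ z → (c * z + d * Out) * X + (0 * z + d * Out) * Y) In≡Out ⟩
  (c * Out + d * Out) * X + (0 * Out + d * Out) * Y
    ≡⟨ rearrange c d X Y Out ⟩
  ((c + d) * X + d * Y) * Out ∎
  where
    open ≡-Reasoning
    Out = Zout T v p q
    rearrange : ∀ c d X Y C → (c * C + d * C) * X + (0 * C + d * C) * Y ≡ ((c + d) * X + d * Y) * C
    rearrange = solve-∀

ZgluedOut ZgluedIn : ∀ {n} → Graph n → Marking n → Fin n → (Fin n → ℕ) → (Fin n → ℕ) → ℕ → ℕ → ℕ
ZgluedOut G A v p q X Y = Zglued G A (update p v 0) (update q v 1) X Y
ZgluedIn  G A v p q X Y = Zglued G A (update p v 1) (update q v 0) X Y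


Zout<φ·Zin⇒gluedBound-markedAt : ∀ {n} (T : Graph n) v i p q X Y → i ≢ v → p v ≡ 1 → q v ≡ 1 →
  Zout T i (update p v X) (update q v (X + Y)) <φ· Zin T i (update p v X) (update q v (X + Y)) →
  ZgluedOut T (markedAt v) i p q X Y <φ· ZgluedIn T (markedAt v) i p q X Y
Zout<φ·Zin⇒gluedBound-markedAt T v i p q X Y i≢v pv≡1 qv≡1 =
  subst₂ _<φ·_ (sym (Zglued-markedAt T v i p q X Y i≢v pv≡1 qv≡1 0 1)) (sym (Zglued-markedAt T v i p q X Y i≢v pv≡1 qv≡1 1 0))

-- (X, X + Y) is the weight that Zglued-markedAt gives to v.
pendant-admissible : ∀ {n} (T : Graph n) v p q X Y → IsLeaf T v → 0 < X → X >φ· Y → ∀ y →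
                     (y ≢ v → AdmissibleAt T unmarked p q y) → AdmissibleAt T unmarked (update p v X) (update q v (X + Y)) y
pendant-admissible T v p q X Y v-leaf X>0 X>φY y adm with y ≟ v
... | yes refl = (λ _ → X>0 , ≤-trans X>0 (m≤m+n X Y) , >φ·⇒+<φ· X Y X>φY) , (λ ¬leaf → ⊥-elim (¬leaf v-leaf))
... | no y≢v   = adm y≢v

gluedBound-markedAt : ∀ {n} (T : Graph n) → TreeInvariant T → (v : Fin n) → IsLeaf T v → (i : Fin n) →
  GluedLeaf T (markedAt v) i → ∀ p q → (∀ y → y ≢ i → AdmissibleAt T (markedAt v) p q y) →
  ∀ X Y → 0 < X → X >φ· Y → ZgluedOut T (markedAt v) i p q X Y <φ· ZgluedIn T (markedAt v) i p q X Y
gluedBound-markedAt T inv v v-leaf i i-leaf p q adm X Y X>0 X>φY with i ≟ v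
... | yes refl =
  subst₂ _<φ·_ (sym (Zglued-markedAt-isolated T v p q X Y In≡Out 0 1)) (sym (Zglued-markedAt-isolated T v p q X Y In≡Out 1 0))
    (subst₂ _<φ·_ (out-weight X Y Out) (in-weight X Y Out)
      (*-mono-<φ· (X + Y) X Out Out (>φ·⇒+<φ· X Y X>φY) ≤-refl (Zout-positive T (markedAt v) v p q adm)))
  where
    Out = Zout T v p q
    In≡Out = Zin≡Zout-degree0 T (TreeInvariant.undirected inv) v (n≤0⇒n≡0 (≤-pred i-leaf)) p q
    out-weight : ∀ X Y C → (X + Y) * C ≡ ((0 + 1) * X + 1 * Y) * C
    out-weight = solve-∀
    in-weight : ∀ X Y C → X * C ≡ ((1 + 0) * X + 0 * Y) * C
    in-weight = solve-∀
... | no i≢v =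
  Zout<φ·Zin⇒gluedBound-markedAt T v i p q X Y i≢v pv≡1 qv≡1
    (TreeInvariant.leafBound inv i i-leaf (update p v X) (update q v (X + Y))
      (λ y y≢i → pendant-admissible T v p q X Y v-leaf X>0 X>φY y (λ y≢v → AdmissibleAt-markedAt T v p q y y≢v (adm y y≢i))))
  where
    v-inner : ¬ GluedLeaf T (markedAt v) v
    v-inner v-glued = i≢v (TreeInvariant.trivialIfIsolated inv v (GluedLeaf-markedAt-self T v v-glued) i)
    pv≡1 : p v ≡ 1
    pv≡1 = proj₁ (proj₂ (adm v (i≢v ∘ sym)) v-inner)
    qv≡1 : q v ≡ 1
    qv≡1 = proj₂ (proj₂ (adm v (i≢v ∘ sym)) v-inner)

↑ˡ≢↑ʳ : ∀ {n N} (i : Fin n) (j : Fin N) → i ↑ˡ N ≢ n ↑ʳ j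
↑ˡ≢↑ʳ {n} {N} i j eq with () ← trans (sym (splitAt-↑ˡ n i N)) (trans (cong (splitAt n) eq) (splitAt-↑ʳ n N j))

data SplitView (n N : ℕ) : Fin (n + N) → Set where
  left  : ∀ i → SplitView n N (i ↑ˡ N)
  right : ∀ j → SplitView n N (n ↑ʳ j)

splitView : ∀ n N x → SplitView n N x
splitView n N x with splitAt n x in eq
... | inj₁ i = subst (SplitView n N) (splitAt⁻¹-↑ˡ eq) (left i)
... | inj₂ j = subst (SplitView n N) (splitAt⁻¹-↑ʳ eq) (right j)

Undirected-disjointUnion : ∀ {m n} (T : Graph m) (G : Graph n) → Undirected T → Undirected G → Undirected (disjointUnion T G)
Undirected-disjointUnion {m} T G undirectedT undirectedG x y = componentwise (splitAt m x) (splitAt m y)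
  where
    componentwise : ∀ u v → duAdj T G u v ≡ duAdj T G v u
    componentwise (inj₁ a) (inj₁ b) = undirectedT a b
    componentwise (inj₁ a) (inj₂ b) = refl
    componentwise (inj₂ a) (inj₁ b) = refl
    componentwise (inj₂ a) (inj₂ b) = undirectedG a b

module Components {n N} (T : Graph n) (G′ : Graph N) (v : Fin n) (A′ : Marking N) where

  G : Graph (n + N)
  G = disjointUnion T G′

  A : Marking (n + N)
  A = attach v A′

  pˡ : (Fin (n + N) → ℕ) → Fin n → ℕ
  pˡ p i = p (i ↑ˡ N)

  pʳ : (Fin (n + N) → ℕ) → Fin N → ℕ
  pʳ p j = p (n ↑ʳ j)

  attach-↑ˡ : ∀ i → A (i ↑ˡ N) ≡ markedAt v i
  attach-↑ˡ i rewrite splitAt-↑ˡ n i N = refl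

  attach-↑ʳ : ∀ j → A (n ↑ʳ j) ≡ A′ j
  attach-↑ʳ j rewrite splitAt-↑ʳ n N j = refl

  GluedLeaf-↑ˡ : ∀ i → GluedLeaf G A (i ↑ˡ N) ≡ GluedLeaf T (markedAt v) i
  GluedLeaf-↑ˡ i = cong (_≤ 1) (cong₂ _+_ (cong 𝟙 (attach-↑ˡ i)) (degree-disjointUnion-↑ˡ T G′ i))

  GluedLeaf-↑ʳ : ∀ j → GluedLeaf G A (n ↑ʳ j) ≡ GluedLeaf G′ A′ j
  GluedLeaf-↑ʳ j = cong (_≤ 1) (cong₂ _+_ (cong 𝟙 (attach-↑ʳ j)) (degree-disjointUnion-↑ʳ T G′ j))

  AdmissibleAt-↑ˡ : ∀ p q i → AdmissibleAt G A p q (i ↑ˡ N) → AdmissibleAt T (markedAt v) (pˡ p) (pˡ q) i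
  AdmissibleAt-↑ˡ p q i = subst (λ L → Admissible L (p (i ↑ˡ N)) (q (i ↑ˡ N))) (GluedLeaf-↑ˡ i)

  AdmissibleAt-↑ʳ : ∀ p q j → AdmissibleAt G A p q (n ↑ʳ j) → AdmissibleAt G′ A′ (pʳ p) (pʳ q) j
  AdmissibleAt-↑ʳ p q j = subst (λ L → Admissible L (p (n ↑ʳ j)) (q (n ↑ʳ j))) (GluedLeaf-↑ʳ j)

  Z-mask-disjointUnion : ∀ p q → Z G (mask A p) q ≡ Z T (update (pˡ p) v 0) (pˡ q) * Z G′ (mask A′ (pʳ p)) (pʳ q)
  Z-mask-disjointUnion p q = trans (Z-disjointUnion T G′ (mask A p) q)
    (cong₂ _*_ (Z-cong T (λ i → cong (λ b → if b then 0 else p (i ↑ˡ N)) (attach-↑ˡ i)) (λ _ → refl))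
               (Z-cong G′ (λ j → cong (λ b → if b then 0 else p (n ↑ʳ j)) (attach-↑ʳ j)) (λ _ → refl)))

  private
    rearrangeˡ : ∀ a b c d X Y → (a * b) * X + (c * d) * Y ≡ a * (b * X) + c * (d * Y)
    rearrangeˡ = solve-∀

    rearrangeʳ : ∀ a b c d X Y → (a * b) * X + (c * d) * Y ≡ b * (a * X) + d * (c * Y)
    rearrangeʳ = solve-∀

  Zglued-↑ˡ : ∀ p q X Y → Zglued G A p q X Y
                        ≡ Zglued T (markedAt v) (pˡ p) (pˡ q) (Z G′ (pʳ p) (pʳ q) * X) (Z G′ (mask A′ (pʳ p)) (pʳ q) * Y)
  Zglued-↑ˡ p q X Y rewrite Z-disjointUnion T G′ p q | Z-mask-disjointUnion p q =
    rearrangeˡ (Z T (pˡ p) (pˡ q)) (Z G′ (pʳ p) (pʳ q)) (Z T (update (pˡ p) v 0) (pˡ q)) (Z G′ (mask A′ (pʳ p)) (pʳ q)) X Y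

  Zglued-↑ʳ : ∀ p q X Y → Zglued G A p q X Y
                        ≡ Zglued G′ A′ (pʳ p) (pʳ q) (Z T (pˡ p) (pˡ q) * X) (Z T (update (pˡ p) v 0) (pˡ q) * Y)
  Zglued-↑ʳ p q X Y rewrite Z-disjointUnion T G′ p q | Z-mask-disjointUnion p q =
    rearrangeʳ (Z T (pˡ p) (pˡ q)) (Z G′ (pʳ p) (pʳ q)) (Z T (update (pˡ p) v 0) (pˡ q)) (Z G′ (mask A′ (pʳ p)) (pʳ q)) X Y

  Z>φ·Z-mask : ∀ p q → Z T (pˡ p) (pˡ q) >φ· Z T (update (pˡ p) v 0) (pˡ q) → (∀ j → 0 < q (n ↑ʳ j)) →
               Z G p q >φ· Z G (mask A p) q
  Z>φ·Z-mask p q T>φ· qʳ>0 = subst₂ _>φ·_ (sym (Z-disjointUnion T G′ p q)) (sym (Z-mask-disjointUnion p q))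
    (*-mono->φ· (Z T (pˡ p) (pˡ q)) (Z T (update (pˡ p) v 0) (pˡ q)) (Z G′ (pʳ p) (pʳ q)) (Z G′ (mask A′ (pʳ p)) (pʳ q))
                T>φ· (Z-mono G′ (mask-≤ A′ (pʳ p)) (λ _ → ≤-refl)) (Z-positive G′ (pʳ p) (pʳ q) qʳ>0))

  Z>φ·Z-maskʳ : ∀ p q → Z G′ (pʳ p) (pʳ q) >φ· Z G′ (mask A′ (pʳ p)) (pʳ q) → (∀ i → 0 < q (i ↑ˡ N)) →
                Z G p q >φ· Z G (mask A p) q
  Z>φ·Z-maskʳ p q G′>φ· qˡ>0 = subst₂ _>φ·_ (sym (Z-disjointUnion T G′ p q)) (sym (Z-mask-disjointUnion p q))
    (*-mono->φ·ʳ (Z T (pˡ p) (pˡ q)) (Z T (update (pˡ p) v 0) (pˡ q)) (Z G′ (pʳ p) (pʳ q)) (Z G′ (mask A′ (pʳ p)) (pʳ q))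
                 G′>φ· (Z-mono T (update-0-≤ (pˡ p) v) (λ _ → ≤-refl)) (Z-positive T (pˡ p) (pˡ q) qˡ>0))

  update-↑ˡ-↑ˡ : ∀ (p : Fin (n + N) → ℕ) i c j → update p (i ↑ˡ N) c (j ↑ˡ N) ≡ update (pˡ p) i c j
  update-↑ˡ-↑ˡ p i c j = update-reindex (_↑ˡ N) (↑ˡ-injective N) p i c j

  update-↑ʳ-↑ʳ : ∀ (p : Fin (n + N) → ℕ) i c j → update p (n ↑ʳ i) c (n ↑ʳ j) ≡ update (pʳ p) i c j
  update-↑ʳ-↑ʳ p i c j = update-reindex (n ↑ʳ_) (↑ʳ-injective n) p i c j

  Zglued-update-↑ˡ : ∀ p q i c d X Y →
    Zglued G A (update p (i ↑ˡ N) c) (update q (i ↑ˡ N) d) X Y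
      ≡ Zglued T (markedAt v) (update (pˡ p) i c) (update (pˡ q) i d) (Z G′ (pʳ p) (pʳ q) * X) (Z G′ (mask A′ (pʳ p)) (pʳ q) * Y)
  Zglued-update-↑ˡ p q i c d X Y = trans (Zglued-↑ˡ (update p (i ↑ˡ N) c) (update q (i ↑ˡ N) d) X Y)
    (trans (Zglued-cong T (markedAt v) (update-↑ˡ-↑ˡ p i c) (update-↑ˡ-↑ˡ q i d) _ _)
           (cong₂ (Zglued T (markedAt v) (update (pˡ p) i c) (update (pˡ q) i d))
                  (cong (_* X) (Z-cong G′ pʳ-unchanged qʳ-unchanged))
                  (cong (_* Y) (Z-cong G′ (λ j → cong (λ z → if A′ j then 0 else z) (pʳ-unchanged j)) qʳ-unchanged))))
    where
      pʳ-unchanged : ∀ j → update p (i ↑ˡ N) c (n ↑ʳ j) ≡ p (n ↑ʳ j)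
      pʳ-unchanged j = update-other p (i ↑ˡ N) c (n ↑ʳ j) (↑ˡ≢↑ʳ i j ∘ sym)
      qʳ-unchanged : ∀ j → update q (i ↑ˡ N) d (n ↑ʳ j) ≡ q (n ↑ʳ j)
      qʳ-unchanged j = update-other q (i ↑ˡ N) d (n ↑ʳ j) (↑ˡ≢↑ʳ i j ∘ sym)

  Zglued-update-↑ʳ : ∀ p q j c d X Y →
    Zglued G A (update p (n ↑ʳ j) c) (update q (n ↑ʳ j) d) X Y
      ≡ Zglued G′ A′ (update (pʳ p) j c) (update (pʳ q) j d) (Z T (pˡ p) (pˡ q) * X) (Z T (update (pˡ p) v 0) (pˡ q) * Y)
  Zglued-update-↑ʳ p q j c d X Y = trans (Zglued-↑ʳ (update p (n ↑ʳ j) c) (update q (n ↑ʳ j) d) X Y)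
    (trans (Zglued-cong G′ A′ (update-↑ʳ-↑ʳ p j c) (update-↑ʳ-↑ʳ q j d) _ _)
           (cong₂ (Zglued G′ A′ (update (pʳ p) j c) (update (pʳ q) j d))
                  (cong (_* X) (Z-cong T pˡ-unchanged qˡ-unchanged))
                  (cong (_* Y) (Z-cong T (λ i → cong (λ z → if ⌊ i ≟ v ⌋ then 0 else z) (pˡ-unchanged i)) qˡ-unchanged))))
    where
      pˡ-unchanged : ∀ i → update p (n ↑ʳ j) c (i ↑ˡ N) ≡ p (i ↑ˡ N)
      pˡ-unchanged i = update-other p (n ↑ʳ j) c (i ↑ˡ N) (↑ˡ≢↑ʳ i j)
      qˡ-unchanged : ∀ i → update q (n ↑ʳ j) d (i ↑ˡ N) ≡ q (i ↑ˡ N)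
      qˡ-unchanged i = update-other q (n ↑ʳ j) d (i ↑ˡ N) (↑ˡ≢↑ʳ i j)

  outˡ inˡ outʳ inʳ : (p q : Fin (n + N) → ℕ) → ℕ → ℕ
  outˡ p q X = Z G′ (pʳ p) (pʳ q) * X
  inˡ  p q Y = Z G′ (mask A′ (pʳ p)) (pʳ q) * Y
  outʳ p q X = Z T (pˡ p) (pˡ q) * X
  inʳ  p q Y = Z T (update (pˡ p) v 0) (pˡ q) * Y

  gluedBound-↑ˡ : ∀ p q i X Y →
    ZgluedOut T (markedAt v) i (pˡ p) (pˡ q) (outˡ p q X) (inˡ p q Y) <φ· ZgluedIn T (markedAt v) i (pˡ p) (pˡ q) (outˡ p q X) (inˡ p q Y) →
    ZgluedOut G A (i ↑ˡ N) p q X Y <φ· ZgluedIn G A (i ↑ˡ N) p q X Y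
  gluedBound-↑ˡ p q i X Y = subst₂ _<φ·_ (sym (Zglued-update-↑ˡ p q i 0 1 X Y)) (sym (Zglued-update-↑ˡ p q i 1 0 X Y))

  gluedBound-↑ʳ : ∀ p q j X Y →
    ZgluedOut G′ A′ j (pʳ p) (pʳ q) (outʳ p q X) (inʳ p q Y) <φ· ZgluedIn G′ A′ j (pʳ p) (pʳ q) (outʳ p q X) (inʳ p q Y) →
    ZgluedOut G A (n ↑ʳ j) p q X Y <φ· ZgluedIn G A (n ↑ʳ j) p q X Y
  gluedBound-↑ʳ p q j X Y = subst₂ _<φ·_ (sym (Zglued-update-↑ʳ p q j 0 1 X Y)) (sym (Zglued-update-↑ʳ p q j 1 0 X Y))

  outˡ-positive : ∀ p q X → (∀ j → 0 < q (n ↑ʳ j)) → 0 < X → 0 < outˡ p q X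
  outˡ-positive p q X qʳ>0 X>0 = *-mono-< (Z-positive G′ (pʳ p) (pʳ q) qʳ>0) X>0

  outʳ-positive : ∀ p q X → (∀ i → 0 < q (i ↑ˡ N)) → 0 < X → 0 < outʳ p q X
  outʳ-positive p q X qˡ>0 X>0 = *-mono-< (Z-positive T (pˡ p) (pˡ q) qˡ>0) X>0

  inʳ≤outʳ : ∀ p q X Y → Y ≤ X → inʳ p q Y ≤ outʳ p q X
  inʳ≤outʳ p q X Y Y≤X = *-mono-≤ (Z-mono T (update-0-≤ (pˡ p) v) (λ _ → ≤-refl)) Y≤X

  outʳ>φ·inʳ : ∀ p q X Y → (∀ i → 0 < q (i ↑ˡ N)) → (Z T (pˡ p) (pˡ q) >φ· Z T (update (pˡ p) v 0) (pˡ q) ⊎ X >φ· Y) →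
               Y ≤ X → 0 < X → outʳ p q X >φ· inʳ p q Y
  outʳ>φ·inʳ p q X Y qˡ>0 (inj₁ T>φ·) Y≤X X>0 = *-mono->φ· (Z T (pˡ p) (pˡ q)) (Z T (update (pˡ p) v 0) (pˡ q)) X Y T>φ· Y≤X X>0
  outʳ>φ·inʳ p q X Y qˡ>0 (inj₂ X>φY) Y≤X X>0 =
    *-mono->φ·ʳ (Z T (pˡ p) (pˡ q)) (Z T (update (pˡ p) v 0) (pˡ q)) X Y X>φY (Z-mono T (update-0-≤ (pˡ p) v) (λ _ → ≤-refl))
      (Z-positive T (pˡ p) (pˡ q) qˡ>0)

record ForestShape {N} (G : Graph N) (A : Marking N) (k : ℕ) : Set where
  field
    undirected     : Undirected G
    isolatedMarked : ∀ y → degree G y ≡ 0 → A y ≡ true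
    marks          : countFin N A ≡ k

ForestShape-cons : ∀ {n k N T G′ A′} → TreeInvariant T → (v : Fin n) → ForestShape {N} G′ A′ k →
                   ForestShape (disjointUnion T G′) (attach v A′) (suc k)
ForestShape-cons {n} {k} {N} {T} {G′} {A′} inv v shape = record
  { undirected     = Undirected-disjointUnion T G′ (TreeInvariant.undirected inv) (ForestShape.undirected shape)
  ; isolatedMarked = isolatedMarked
  ; marks          = trans (countFin-↑ n N _) (cong₂ _+_ (trans (countFin-cong n attach-↑ˡ) (countFin-≟ n v))
                                                        (trans (countFin-cong N attach-↑ʳ) (ForestShape.marks shape)))
  }
  where
    open Components T G′ v A′
    isolatedMarked : ∀ y → degree G y ≡ 0 → A y ≡ true
    isolatedMarked y deg≡0 with splitView n N y
    ... | left i with refl ← TreeInvariant.trivialIfIsolated inv i (trans (sym (degree-disjointUnion-↑ˡ T G′ i)) deg≡0) v =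
      trans (attach-↑ˡ i) (markedAt-self i)
    ... | right j = trans (attach-↑ʳ j) (ForestShape.isolatedMarked shape j (trans (sym (degree-disjointUnion-↑ʳ T G′ j)) deg≡0))

ForestMaskBound : ∀ {N} → Graph N → Marking N → Set
ForestMaskBound G A = ∀ p q → (∀ y → AdmissibleAt G A p q y) → Z G p q >φ· Z G (mask A p) q

ForestMaskBound-cons : ∀ {n N T G′ A′} → TreeInvariant T → (v : Fin n) → IsLeaf T v →
                       ForestMaskBound {n + N} (disjointUnion T G′) (attach v A′)
ForestMaskBound-cons {n} {N} {T} {G′} {A′} inv v v-leaf p q adm =
  Z>φ·Z-mask p q (forbid->φ· T inv v v-leaf (pˡ p) (pˡ q) (λ i → AdmissibleAt-↑ˡ p q i (adm (i ↑ˡ N))))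
    (λ j → AdmissibleAt⇒out-positive G A p q (n ↑ʳ j) (adm (n ↑ʳ j)))
  where open Components T G′ v A′

scaled->φ· : ∀ {N} (G : Graph N) A p q → (∀ y → AdmissibleAt G A p q y) → ∀ X Y → Y ≤ X → 0 < X →
             (Z G p q >φ· Z G (mask A p) q ⊎ X >φ· Y) → (Z G p q * X) >φ· (Z G (mask A p) q * Y)
scaled->φ· G A p q adm X Y Y≤X X>0 (inj₁ Z>φZmask) = *-mono->φ· (Z G p q) (Z G (mask A p) q) X Y Z>φZmask Y≤X X>0
scaled->φ· G A p q adm X Y Y≤X X>0 (inj₂ X>φY) =
  *-mono->φ·ʳ (Z G p q) (Z G (mask A p) q) X Y X>φY (Z-mono G (mask-≤ A p) (λ _ → ≤-refl))
    (Z-positive G p q (λ y → AdmissibleAt⇒out-positive G A p q y (adm y)))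

-- The condition X > φ Y is needed only when the glued vertex would be a leaf.
ForestGluedBound : ∀ {N} → Graph N → Marking N → ℕ → Set
ForestGluedBound G A k = ∀ v → GluedLeaf G A v → ∀ p q → (∀ y → y ≢ v → AdmissibleAt G A p q y) →
                         ∀ X Y → Y ≤ X → 0 < X → (2 ≤ k ⊎ X >φ· Y) → ZgluedOut G A v p q X Y <φ· ZgluedIn G A v p q X Y

module GluedBoundCons {n k N : ℕ} {T : Graph n} {G′ : Graph N} {A′ : Marking N} (inv : TreeInvariant T) (v : Fin n) (v-leaf : IsLeaf T v) where
  open Components T G′ v A′

  at-↑ˡ : (1 ≤ k → ForestMaskBound G′ A′) → ∀ i → GluedLeaf G A (i ↑ˡ N) → ∀ p q →
          (∀ y → y ≢ i ↑ˡ N → AdmissibleAt G A p q y) → ∀ X Y → Y ≤ X → 0 < X → (2 ≤ suc k ⊎ X >φ· Y) →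
          ZgluedOut G A (i ↑ˡ N) p q X Y <φ· ZgluedIn G A (i ↑ˡ N) p q X Y
  at-↑ˡ G′-bound i i-leaf p q adm X Y Y≤X X>0 2≤k⊎X>φY = gluedBound-↑ˡ p q i X Y
    (gluedBound-markedAt T inv v v-leaf i (subst id (GluedLeaf-↑ˡ i) i-leaf) (pˡ p) (pˡ q)
      (λ y y≢i → AdmissibleAt-↑ˡ p q y (adm (y ↑ˡ N) (y≢i ∘ ↑ˡ-injective N y i)))
      (outˡ p q X) (inˡ p q Y)
      (outˡ-positive p q X (λ j → AdmissibleAt⇒out-positive G′ A′ (pʳ p) (pʳ q) j (admʳ j)) X>0)
      (scaled->φ· G′ A′ (pʳ p) (pʳ q) admʳ X Y Y≤X X>0
        (Sum.map (λ { (s≤s 1≤k) → G′-bound 1≤k (pʳ p) (pʳ q) admʳ }) id 2≤k⊎X>φY)))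
    where
      admʳ : ∀ j → AdmissibleAt G′ A′ (pʳ p) (pʳ q) j
      admʳ j = AdmissibleAt-↑ʳ p q j (adm (n ↑ʳ j) (↑ˡ≢↑ʳ i j ∘ sym))

  at-↑ʳ : ForestGluedBound G′ A′ k → ∀ j → GluedLeaf G A (n ↑ʳ j) → ∀ p q →
          (∀ y → y ≢ n ↑ʳ j → AdmissibleAt G A p q y) → ∀ X Y → Y ≤ X → 0 < X →
          ZgluedOut G A (n ↑ʳ j) p q X Y <φ· ZgluedIn G A (n ↑ʳ j) p q X Y
  at-↑ʳ G′-bound j j-leaf p q adm X Y Y≤X X>0 = gluedBound-↑ʳ p q j X Y
    (G′-bound j (subst id (GluedLeaf-↑ʳ j) j-leaf) (pʳ p) (pʳ q)
      (λ y y≢j → AdmissibleAt-↑ʳ p q y (adm (n ↑ʳ y) (y≢j ∘ ↑ʳ-injective n y j)))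
      (outʳ p q X) (inʳ p q Y) (inʳ≤outʳ p q X Y Y≤X) (outʳ-positive p q X qˡ>0 X>0)
      (inj₂ (outʳ>φ·inʳ p q X Y qˡ>0 (inj₁ (forbid->φ· T inv v v-leaf (pˡ p) (pˡ q) admˡ)) Y≤X X>0)))
    where
      admˡ : ∀ i → AdmissibleAt T (markedAt v) (pˡ p) (pˡ q) i
      admˡ i = AdmissibleAt-↑ˡ p q i (adm (i ↑ˡ N) (↑ˡ≢↑ʳ i j))
      qˡ>0 : ∀ i → 0 < q (i ↑ˡ N)
      qˡ>0 i = AdmissibleAt⇒out-positive T (markedAt v) (pˡ p) (pˡ q) i (admˡ i)

ForestGluedBound-cons : ∀ {n k N T G′ A′} → TreeInvariant T → (v : Fin n) → IsLeaf T v →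
                        (1 ≤ k → ForestMaskBound G′ A′) → ForestGluedBound {N} G′ A′ k →
                        ForestGluedBound (disjointUnion T G′) (attach v A′) (suc k)
ForestGluedBound-cons {n} {k} {N} inv v v-leaf G′-mask G′-bound x x-leaf p q adm X Y Y≤X X>0 2≤k⊎X>φY
  with splitView n N x
... | left i  = GluedBoundCons.at-↑ˡ inv v v-leaf G′-mask i x-leaf p q adm X Y Y≤X X>0 2≤k⊎X>φY
... | right j = GluedBoundCons.at-↑ʳ inv v v-leaf G′-bound j x-leaf p q adm X Y Y≤X X>0

module Relabel {n} {G H : Graph n} (σ : Permutation′ n) (H≅G : Relabelling G H σ) where
  σʳ σˡ : Fin n → Fin n
  σʳ = σ ⟨$⟩ʳ_
  σˡ = σ ⟨$⟩ˡ_

  σʳ-injective : ∀ {a b} → σʳ a ≡ σʳ b → a ≡ b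
  σʳ-injective eq = trans (sym (inverseˡ σ)) (trans (cong σˡ eq) (inverseˡ σ))

  σˡ-injective : ∀ a b → σˡ a ≡ σˡ b → a ≡ b
  σˡ-injective a b eq = trans (sym (inverseʳ σ)) (trans (cong σʳ eq) (inverseʳ σ))

  ≢-σˡ : ∀ {y v} → y ≢ σʳ v → σˡ y ≢ v
  ≢-σˡ y≢σv σy≡v = y≢σv (trans (sym (inverseʳ σ)) (cong σʳ σy≡v))

  degree-σˡ : ∀ y → degree H (σˡ y) ≡ degree G y
  degree-σˡ y = trans (degree-relabel G H σ H≅G (σˡ y)) (cong (degree G) (inverseʳ σ))

  IsLeaf-σʳ : ∀ {x} → IsLeaf H x → IsLeaf G (σʳ x)
  IsLeaf-σʳ {x} = subst (_≤ 1) (degree-relabel G H σ H≅G x)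

  AdmissibleAt-σˡ : ∀ p q y → AdmissibleAt H unmarked p q (σˡ y) → AdmissibleAt G unmarked (p ∘ σˡ) (q ∘ σˡ) y
  AdmissibleAt-σˡ p q y = subst (λ d → Admissible (d ≤ 1) (p (σˡ y)) (q (σˡ y))) (degree-σˡ y)

  Z-update-σ : ∀ v p q c d → Z H (update p v c) (update q v d) ≡ Z G (update (p ∘ σˡ) (σʳ v) c) (update (q ∘ σˡ) (σʳ v) d)
  Z-update-σ v p q c d = trans (Z-relabel G H σ H≅G (update p v c) (update q v d)) (Z-cong G (reindex p c) (reindex q d))
    where
      reindex : ∀ (f : Fin n → ℕ) c y → update f v c (σˡ y) ≡ update (f ∘ σˡ) (σʳ v) c y
      reindex f c y = trans (cong (λ u → update f u c (σˡ y)) (sym (inverseˡ σ))) (update-reindex σˡ σˡ-injective f (σʳ v) c y)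

TreeInvariant-single : TreeInvariant {1} (λ _ _ → false)
TreeInvariant-single = record
  { undirected        = λ _ _ → refl
  ; trivialIfIsolated = λ { zero _ zero → refl }
  ; leafBound         = λ { zero _ p q _ → subst (Zout {1} (λ _ _ → false) zero p q <φ·_)
                                (sym (Zin≡Zout-isolated (λ _ _ → false) zero (λ _ → refl) (λ _ → refl) p q))
                                (n<φ·n _ (Z-positive {1} (λ _ _ → false) (update p zero 0) (update q zero 1) (λ { zero → s≤s z≤n }))) }
  }

TreeInvariant-relabel : ∀ {n G H} → TreeInvariant {n} G → (σ : Permutation′ n) → Relabelling G H σ → TreeInvariant H
TreeInvariant-relabel {n} {G} {H} inv σ H≅G = record
  { undirected        = λ x y → trans (H≅G x y) (trans (TreeInvariant.undirected inv _ _) (sym (H≅G y x)))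
  ; trivialIfIsolated = λ x deg≡0 z → σʳ-injective
      (TreeInvariant.trivialIfIsolated inv (σʳ x) (trans (sym (degree-relabel G H σ H≅G x)) deg≡0) (σʳ z))
  ; leafBound         = λ v v-leaf p q adm →
      subst₂ _<φ·_ (sym (Z-update-σ v p q 0 1)) (sym (Z-update-σ v p q 1 0))
        (TreeInvariant.leafBound inv (σʳ v) (IsLeaf-σʳ v-leaf) (p ∘ σˡ) (q ∘ σˡ)
          (λ y y≢σv → AdmissibleAt-σˡ p q y (adm (σˡ y) (≢-σˡ y≢σv))))
  }
  where open Relabel {G = G} σ H≅G

Zglued-addVertex-update : ∀ {N} (A : Marking N) (G : Graph N) p q → p zero ≡ 1 → q zero ≡ 1 → ∀ v c d →
                          Z (addVertex A G) (update p (suc v) c) (update q (suc v) d)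
                            ≡ Zglued G A (update (p ∘ suc) v c) (update (q ∘ suc) v d) 1 1
Zglued-addVertex-update A G p q p₀≡1 q₀≡1 v c d =
  trans (Zglued-addVertex A G (update p (suc v) c) (update q (suc v) d) p₀≡1 q₀≡1)
        (Zglued-cong G A (update-reindex suc (λ _ _ → suc-injective) p v c) (update-reindex suc (λ _ _ → suc-injective) q v d) 1 1)

module Glue {k N : ℕ} {G : Graph N} {A : Marking N} (2≤k : 2 ≤ k) (shape : ForestShape G A k) where
  T : Graph (suc N)
  T = addVertex A G

  centre-not-leaf : ¬ IsLeaf T zero
  centre-not-leaf leaf = <⇒≱ 2≤k (subst (_≤ 1) (ForestShape.marks shape) leaf)

  undirected : Undirected T
  undirected zero    zero    = refl
  undirected zero    (suc y) = refl
  undirected (suc x) zero    = refl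
  undirected (suc x) (suc y) = ForestShape.undirected shape x y

  trivialIfIsolated : TrivialIfIsolated T
  trivialIfIsolated zero    deg≡0 _ = ⊥-elim (centre-not-leaf (≤-trans (≤-reflexive deg≡0) z≤n))
  trivialIfIsolated (suc x) deg≡0 _ with A x in marked
  ... | false with () ← trans (sym marked) (ForestShape.isolatedMarked shape x deg≡0)
  ... | true  with () ← deg≡0

TreeInvariant-glue : ∀ {k N G A} → 2 ≤ k → ForestShape {N} G A k → ForestGluedBound G A k → TreeInvariant (addVertex A G)
TreeInvariant-glue {k} {N} {G} {A} 2≤k shape bound = record
  { undirected        = undirected
  ; trivialIfIsolated = trivialIfIsolated
  ; leafBound         = leafBound
  }
  where
    open Glue 2≤k shape
    leafBound : LeafBound T
    leafBound zero    leaf = ⊥-elim (centre-not-leaf leaf)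
    leafBound (suc v) leaf p q adm =
      subst₂ _<φ·_ (sym (Zglued-addVertex-update A G p q p₀≡1 q₀≡1 v 0 1)) (sym (Zglued-addVertex-update A G p q p₀≡1 q₀≡1 v 1 0))
        (bound v leaf (p ∘ suc) (q ∘ suc) (λ y y≢v → adm (suc y) (y≢v ∘ suc-injective)) 1 1 ≤-refl (s≤s z≤n) (inj₁ 2≤k))
      where
        p₀≡1 : p zero ≡ 1
        p₀≡1 = proj₁ (proj₂ (adm zero (λ ())) centre-not-leaf)
        q₀≡1 : q zero ≡ 1
        q₀≡1 = proj₂ (proj₂ (adm zero (λ ())) centre-not-leaf)

mutual
  treeInvariant : ∀ {n T} → TreeOfStars n T → TreeInvariant T
  treeInvariant single            = TreeInvariant-single
  treeInvariant (glue 2≤k F)      = TreeInvariant-glue 2≤k (forestShape F) (forestGluedBound F)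
  treeInvariant (relabel t σ H≅G) = TreeInvariant-relabel (treeInvariant t) σ H≅G

  forestShape : ∀ {k N G A} → StarForest k N G A → ForestShape G A k
  forestShape nil             = record { undirected = λ () ; isolatedMarked = λ () ; marks = refl }
  forestShape (cons t v _ F)  = ForestShape-cons (treeInvariant t) v (forestShape F)

  forestMaskBound : ∀ {k N G A} → StarForest k N G A → 1 ≤ k → ForestMaskBound G A
  forestMaskBound (cons t v v-leaf _) _ = ForestMaskBound-cons (treeInvariant t) v v-leaf

  forestGluedBound : ∀ {k N G A} → StarForest k N G A → ForestGluedBound G A k
  forestGluedBound (cons t v v-leaf F) = ForestGluedBound-cons (treeInvariant t) v v-leaf (forestMaskBound F) (forestGluedBound F)

F≡Zin+Zout : ∀ {m} (T : Graph (suc m)) v → F T ≡ Zout T v one one + Zin T v one one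
F≡Zin+Zout T v = trans (F≡Z-one T) (trans (Z-split T v one one) (swap (Zin T v one one) (Zout T v one one)))
  where
    swap : ∀ a b → 1 * a + 1 * b ≡ b + a
    swap = solve-∀

F>φ·F-removeVertex : ∀ {m} (T : Graph (suc m)) v → Zout T v one one <φ· Zin T v one one → F T >φ· F (removeVertex T v)
F>φ·F-removeVertex T v Zout<φ·Zin =
  subst₂ _>φ·_ (sym (F≡Zin+Zout T v)) (trans (Zout≡Z-removeVertex T v one one) (sym (F≡Z-one (removeVertex T v))))
         (<φ·⇒+>φ· (Zout T v one one) (Zin T v one one) Zout<φ·Zin)

one-admissible : ∀ {n} (G : Graph n) A y → AdmissibleAt G A one one y
one-admissible G A y = (λ _ → s≤s z≤n , s≤s z≤n , s≤s (s≤s z≤n)) , (λ _ → refl , refl)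

treeOfStars-F>φ·F-removeLeaf : ∀ m (T : Graph (suc m)) → TreeOfStars (suc m) T → ∀ v → IsLeaf T v → F T >φ· F (removeVertex T v)
treeOfStars-F>φ·F-removeLeaf m T t v v-leaf =
  F>φ·F-removeVertex T v (TreeInvariant.leafBound (treeInvariant t) v v-leaf one one (λ y _ → one-admissible T unmarked y))

-- Paths

Consecutive : ℕ → ℕ → Set
Consecutive a b = a ≡ suc b ⊎ b ≡ suc a

Consecutive-sym : ∀ {a b} → Consecutive a b → Consecutive b a
Consecutive-sym = Sum.swap

record PathOrder {n} (G : Graph n) (a b : Fin n) : Set where
  field
    ord              : Fin n → ℕ
    ord<n            : ∀ y → ord y < n
    ord-injective    : ∀ y z → ord y ≡ ord z → y ≡ z
    edge⇒consecutive : ∀ y z → G y z ≡ true → Consecutive (ord y) (ord z)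
    consecutive⇒edge : ∀ y z → Consecutive (ord y) (ord z) → G y z ≡ true
    ord-start        : ord a ≡ 0
    ord-end          : suc (ord b) ≡ n

LeavesAmong : ∀ {n} → Graph n → Fin n → Fin n → Set
LeavesAmong G a b = ∀ y → IsLeaf G y → y ≡ a ⊎ y ≡ b

-- The second component follows from the first, but carrying it avoids counting degrees along a path.
PathBetween : ∀ {n} → Graph n → Fin n → Fin n → Set
PathBetween G a b = PathOrder G a b × LeavesAmong G a b

Consecutive-reverse : ∀ r s a b → r + suc a ≡ s + suc b → Consecutive r s → Consecutive a b
Consecutive-reverse r s a b sum≡ (inj₁ refl) =
  inj₂ (ℕ.suc-injective (+-cancelˡ-≡ s (suc b) (suc (suc a)) (trans (sym sum≡) (sym (+-suc s (suc a))))))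
Consecutive-reverse r s a b sum≡ (inj₂ refl) =
  inj₁ (ℕ.suc-injective (+-cancelˡ-≡ r (suc a) (suc (suc b)) (trans sum≡ (sym (+-suc r (suc b))))))

PathOrder-reverse : ∀ {n} {G : Graph n} {a b} → PathOrder G a b → PathOrder G b a
PathOrder-reverse {n} {G} {a} {b} P = record
  { ord              = rev
  ; ord<n            = λ y → subst (rev y <_) (rev+ord y) (m<m+n (rev y) (s≤s z≤n))
  ; ord-injective    = λ y z eq → ord-injective y z (ℕ.suc-injective (+-cancelˡ-≡ (rev y) _ _
                         (trans (rev+ord y) (trans (sym (rev+ord z)) (cong (_+ suc (ord z)) (sym eq))))))
  ; edge⇒consecutive = λ y z e → Consecutive-reverse (ord y) (ord z) (rev y) (rev z) (sum≡ y z) (edge⇒consecutive y z e)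
  ; consecutive⇒edge = λ y z c → consecutive⇒edge y z (Consecutive-reverse (rev y) (rev z) (ord y) (ord z) (sum≡′ y z) c)
  ; ord-start        = trans (cong (n ∸_) ord-end) (n∸n≡0 n)
  ; ord-end          = trans (cong suc (sym (+-identityʳ (rev a))))
                             (trans (sym (+-suc (rev a) 0)) (trans (cong (λ z → rev a + suc z) (sym ord-start)) (rev+ord a)))
  }
  where
    open PathOrder P
    rev : Fin n → ℕ
    rev y = n ∸ suc (ord y)
    rev+ord : ∀ y → rev y + suc (ord y) ≡ n
    rev+ord y = m∸n+n≡m (ord<n y)
    ord+rev : ∀ y → ord y + suc (rev y) ≡ n
    ord+rev y = trans (+-suc (ord y) (rev y)) (trans (+-comm (suc (ord y)) (rev y)) (rev+ord y))
    sum≡ : ∀ y z → ord y + suc (rev y) ≡ ord z + suc (rev z)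
    sum≡ y z = trans (ord+rev y) (sym (ord+rev z))
    sum≡′ : ∀ y z → rev y + suc (ord y) ≡ rev z + suc (ord z)
    sum≡′ y z = trans (rev+ord y) (sym (rev+ord z))

PathBetween-reverse : ∀ {n} {G : Graph n} {a b} → PathBetween G a b → PathBetween G b a
PathBetween-reverse (P , leaves) = PathOrder-reverse P , (λ y leaf → Sum.swap (leaves y leaf))

PathBetween-relabel : ∀ {n} (G H : Graph n) (σ : Permutation′ n) → Relabelling G H σ →
                      ∀ a b → PathBetween G (σ ⟨$⟩ʳ a) (σ ⟨$⟩ʳ b) → PathBetween H a b
PathBetween-relabel {n} G H σ H≅G a b (P , leaves) =
  record
    { ord              = ord ∘ σʳ
    ; ord<n            = ord<n ∘ σʳ
    ; ord-injective    = λ y z eq → σʳ-injective (ord-injective _ _ eq)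
    ; edge⇒consecutive = λ y z e → edge⇒consecutive (σʳ y) (σʳ z) (trans (sym (H≅G y z)) e)
    ; consecutive⇒edge = λ y z c → trans (H≅G y z) (consecutive⇒edge (σʳ y) (σʳ z) c)
    ; ord-start        = ord-start
    ; ord-end          = ord-end
    } ,
  (λ y leaf → Sum.map σʳ-injective σʳ-injective (leaves (σʳ y) (IsLeaf-σʳ leaf)))
  where
    open PathOrder P
    open Relabel {G = G} σ H≅G

PathBetween-isolated : ∀ {n} (G : Graph n) → TrivialIfIsolated G → ∀ v → degree G v ≡ 0 → PathBetween G v v
PathBetween-isolated {suc (suc m)} G trivial v deg≡0 with () ← trans (trivial v deg≡0 zero) (sym (trivial v deg≡0 (suc zero)))
PathBetween-isolated {suc zero} G trivial v deg≡0 =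
  record
    { ord              = λ _ → 0
    ; ord<n            = λ _ → s≤s z≤n
    ; ord-injective    = λ y z _ → trans (trivial v deg≡0 y) (sym (trivial v deg≡0 z))
    ; edge⇒consecutive = λ y z e → ⊥-elim (false≢true (trans (sym (no-edge y z)) e))
    ; consecutive⇒edge = λ { _ _ (inj₁ ()) ; _ _ (inj₂ ()) }
    ; ord-start        = refl
    ; ord-end          = refl
    } ,
  (λ y _ → inj₁ (trivial v deg≡0 y))
  where
    false≢true : false ≢ true
    false≢true ()
    no-edge : ∀ y z → G y z ≡ false
    no-edge y z rewrite trivial v deg≡0 y | trivial v deg≡0 z = countFin≡0 1 (G v) deg≡0 v

consecutive? : ℕ → ℕ → Bool
consecutive? i j = (i ≡ᵇ suc j) ∨ (j ≡ᵇ suc i)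

consecutive?⇒Consecutive : ∀ i j → consecutive? i j ≡ true → Consecutive i j
consecutive?⇒Consecutive i j c =
  Sum.map (≡ᵇ⇒≡ i (suc j)) (≡ᵇ⇒≡ j (suc i)) (Equivalence.to T-∨ (Equivalence.from T-≡ c))

Consecutive⇒consecutive? : ∀ i j → Consecutive i j → consecutive? i j ≡ true
Consecutive⇒consecutive? i j c =
  Equivalence.to T-≡ (Equivalence.from T-∨ (Sum.map (≡⇒≡ᵇ i (suc j)) (≡⇒≡ᵇ j (suc i)) c))

injective⇒surjective : ∀ {n} (f : Fin n → Fin n) → (∀ a b → f a ≡ f b → a ≡ b) → ∀ j → ∃ λ i → f i ≡ j
injective⇒surjective {n} f f-inj j with any? (λ i → f i ≟ j)
... | yes hit = hit
... | no miss = ⊥-elim (missed n f f-inj j miss)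
  where
    missed : ∀ n (f : Fin n → Fin n) → (∀ a b → f a ≡ f b → a ≡ b) → ∀ j → ¬ (∃ λ i → f i ≡ j) → ⊥
    missed (suc n) f f-inj j miss = <-irrefl refl (injective⇒≤ {f = squeeze} squeeze-injective)
      where
        j≢f : ∀ i → j ≢ f i
        j≢f i eq = miss (i , sym eq)
        squeeze : Fin (suc n) → Fin n
        squeeze i = punchOut (j≢f i)
        squeeze-injective : ∀ {a b} → squeeze a ≡ squeeze b → a ≡ b
        squeeze-injective {a} {b} eq = f-inj a b (punchOut-injective (j≢f a) (j≢f b) eq)

injective⇒permutation : ∀ {n} (f : Fin n → Fin n) → (∀ a b → f a ≡ f b → a ≡ b) →
                        Σ (Permutation′ n) λ σ → ∀ x → σ ⟨$⟩ʳ x ≡ f x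
injective⇒permutation f f-inj =
  permutation f (proj₁ ∘ injective⇒surjective f f-inj) (proj₂ ∘ injective⇒surjective f f-inj)
              (λ i → f-inj _ _ (proj₂ (injective⇒surjective f f-inj (f i)))) ,
  (λ _ → refl)

IsPath-removeVertex : ∀ {m} (G : Graph (suc (suc m))) a → PathOrder G a zero → IsPath (removeVertex G zero)
IsPath-removeVertex {m} G a P =
  proj₁ σ , λ x y → trans (as-path x y) (cong₂ (pathGraph (suc m)) (sym (proj₂ σ x)) (sym (proj₂ σ y)))
  where
    open PathOrder P
    position : Fin (suc m) → ℕ
    position y = ord (suc y)
    position<1+m : ∀ y → position y < suc m
    position<1+m y with m<1+n⇒m<n∨m≡n (ord<n (suc y))
    ... | inj₁ lt = lt
    ... | inj₂ eq with () ← ord-injective (suc y) zero (ℕ.suc-injective (trans (cong suc eq) (sym ord-end)))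
    f : Fin (suc m) → Fin (suc m)
    f y = fromℕ< (position<1+m y)
    toℕ-f : ∀ y → toℕ (f y) ≡ position y
    toℕ-f y = toℕ-fromℕ< (position<1+m y)
    σ : Σ (Permutation′ (suc m)) λ σ → ∀ x → σ ⟨$⟩ʳ x ≡ f x
    σ = injective⇒permutation f (λ a b eq →
          suc-injective (ord-injective (suc a) (suc b) (trans (sym (toℕ-f a)) (trans (cong toℕ eq) (toℕ-f b)))))
    as-path : ∀ x y → removeVertex G zero x y ≡ pathGraph (suc m) (f x) (f y)
    as-path x y rewrite toℕ-f x | toℕ-f y =
      true⇔true⇒≡ (λ e → Consecutive⇒consecutive? (position x) (position y) (edge⇒consecutive (suc x) (suc y) e))
                  (λ c → consecutive⇒edge (suc x) (suc y) (consecutive?⇒Consecutive (position x) (position y) c))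

-- Positions along the glued path: those of T₁, then the centre at n₁, then those of T₂ shifted by n₁ + 1.
module GluedPaths {n₁ n₂} (T₁ : Graph n₁) (T₂ : Graph n₂) (v₁ : Fin n₁) (v₂ : Fin n₂) (A₀ : Marking 0)
                  (a : Fin n₁) (b : Fin n₂) (P₁ : PathOrder T₁ a v₁) (P₂ : PathOrder T₂ v₂ b) where
  M : ℕ
  M = n₂ + 0

  G : Graph (n₁ + M)
  G = disjointUnion T₁ (disjointUnion T₂ emptyGraph)

  A : Marking (n₁ + M)
  A = attach v₁ (attach v₂ A₀)

  T : Graph (suc (n₁ + M))
  T = addVertex A G

  module P₁ = PathOrder P₁
  module P₂ = PathOrder P₂

  L : Fin n₁ → Fin (suc (n₁ + M))
  L i = suc (i ↑ˡ M)
  R : Fin n₂ → Fin (suc (n₁ + M))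
  R j = suc (n₁ ↑ʳ (j ↑ˡ 0))

  data Part : Fin (suc (n₁ + M)) → Set where
    centre : Part zero
    inL    : ∀ i → Part (L i)
    inR    : ∀ j → Part (R j)

  part : ∀ y → Part y
  part zero = centre
  part (suc y) with splitView n₁ M y
  ... | left i  = inL i
  ... | right j with splitView n₂ 0 j
  ... | left j′ = inR j′

  ord : Fin (suc (n₁ + M)) → ℕ
  ord zero    = n₁
  ord (suc y) = [ P₁.ord , (λ j → [ (λ j′ → suc (n₁ + P₂.ord j′)) , (λ _ → 0) ]′ (splitAt n₂ j)) ]′ (splitAt n₁ y)

  ord-L : ∀ i → ord (L i) ≡ P₁.ord i
  ord-L i rewrite splitAt-↑ˡ n₁ i M = refl
  ord-R : ∀ j → ord (R j) ≡ suc (n₁ + P₂.ord j)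
  ord-R j rewrite splitAt-↑ʳ n₁ M (j ↑ˡ 0) | splitAt-↑ˡ n₂ j 0 = refl

  A-L : ∀ i → A (i ↑ˡ M) ≡ markedAt v₁ i
  A-L i = Components.attach-↑ˡ T₁ (disjointUnion T₂ emptyGraph) v₁ (attach v₂ A₀) i
  A-R : ∀ j → A (n₁ ↑ʳ (j ↑ˡ 0)) ≡ markedAt v₂ j
  A-R j = trans (Components.attach-↑ʳ T₁ (disjointUnion T₂ emptyGraph) v₁ (attach v₂ A₀) (j ↑ˡ 0))
                (Components.attach-↑ˡ T₂ emptyGraph v₂ A₀ j)

  T-LL : ∀ i j → T (L i) (L j) ≡ T₁ i j
  T-LL i j = disjointUnion-↑ˡ-↑ˡ T₁ _ i j
  T-RR : ∀ i j → T (R i) (R j) ≡ T₂ i j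
  T-RR i j = trans (disjointUnion-↑ʳ-↑ʳ T₁ _ (i ↑ˡ 0) (j ↑ˡ 0)) (disjointUnion-↑ˡ-↑ˡ T₂ emptyGraph i j)
  T-LR : ∀ i j → T (L i) (R j) ≡ false
  T-LR i j = disjointUnion-↑ˡ-↑ʳ T₁ _ i (j ↑ˡ 0)
  T-RL : ∀ i j → T (R i) (L j) ≡ false
  T-RL i j = disjointUnion-↑ʳ-↑ˡ T₁ _ (i ↑ˡ 0) j

  false≢true : false ≢ true
  false≢true ()

  centre-L : ∀ i → markedAt v₁ i ≡ true → Consecutive n₁ (P₁.ord i)
  centre-L i marked with i ≟ v₁
  ... | yes refl = inj₁ (sym P₁.ord-end)
  L-centre : ∀ i → Consecutive n₁ (P₁.ord i) → markedAt v₁ i ≡ true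
  L-centre i (inj₁ eq) with i ≟ v₁
  ... | yes _   = refl
  ... | no i≢v₁ = ⊥-elim (i≢v₁ (P₁.ord-injective i v₁ (ℕ.suc-injective (trans (sym eq) (sym P₁.ord-end)))))
  L-centre i (inj₂ eq) = ⊥-elim (<-asym (P₁.ord<n i) (subst (n₁ <_) (sym eq) (n<1+n n₁)))

  centre-R : ∀ j → markedAt v₂ j ≡ true → Consecutive n₁ (suc (n₁ + P₂.ord j))
  centre-R j marked with j ≟ v₂
  ... | yes refl = inj₂ (cong suc (trans (cong (n₁ +_) P₂.ord-start) (+-identityʳ n₁)))
  R-centre : ∀ j → Consecutive n₁ (suc (n₁ + P₂.ord j)) → markedAt v₂ j ≡ true
  R-centre j (inj₁ eq) = ⊥-elim (<-irrefl eq (s≤s (≤-trans (m≤m+n n₁ _) (n≤1+n _))))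
  R-centre j (inj₂ eq) with j ≟ v₂
  ... | yes _   = refl
  ... | no j≢v₂ = ⊥-elim (j≢v₂ (P₂.ord-injective j v₂
                    (trans (+-cancelˡ-≡ n₁ _ _ (trans (ℕ.suc-injective eq) (sym (+-identityʳ n₁)))) (sym P₂.ord-start))))

  shift-Consecutive : ∀ x y → Consecutive (suc (n₁ + x)) (suc (n₁ + y)) ⇔ Consecutive x y
  shift-Consecutive x y = mk⇔
    (λ { (inj₁ eq) → inj₁ (+-cancelˡ-≡ n₁ _ _ (trans (ℕ.suc-injective eq) (sym (+-suc n₁ y))))
       ; (inj₂ eq) → inj₂ (+-cancelˡ-≡ n₁ _ _ (trans (ℕ.suc-injective eq) (sym (+-suc n₁ x)))) })
    (λ { (inj₁ eq) → inj₁ (cong suc (trans (cong (n₁ +_) eq) (+-suc n₁ y)))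
       ; (inj₂ eq) → inj₂ (cong suc (trans (cong (n₁ +_) eq) (+-suc n₁ x))) })

  L≁R : ∀ i j → ¬ Consecutive (P₁.ord i) (suc (n₁ + P₂.ord j))
  L≁R i j (inj₁ eq) = <-asym (P₁.ord<n i) (subst (n₁ <_) (sym eq) (s≤s (≤-trans (m≤m+n n₁ _) (n≤1+n _))))
  L≁R i j (inj₂ eq) = <-irrefl refl (≤-trans (P₁.ord<n i) (≤-trans (m≤m+n n₁ (P₂.ord j)) (≤-reflexive (ℕ.suc-injective eq))))

  L<R : ∀ i j → P₁.ord i < suc (n₁ + P₂.ord j)
  L<R i j = ≤-trans (P₁.ord<n i) (≤-trans (m≤m+n n₁ (P₂.ord j)) (n≤1+n _))

  centre≁centre : ¬ Consecutive n₁ n₁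
  centre≁centre (inj₁ eq) = <-irrefl eq (n<1+n n₁)
  centre≁centre (inj₂ eq) = <-irrefl eq (n<1+n n₁)

  edge⇒consecutive : ∀ y z → T y z ≡ true → Consecutive (ord y) (ord z)
  edge⇒consecutive y z e with part y | part z
  ... | centre | centre = ⊥-elim (false≢true e)
  ... | centre | inL i  = subst (Consecutive n₁) (sym (ord-L i)) (centre-L i (trans (sym (A-L i)) e))
  ... | centre | inR j  = subst (Consecutive n₁) (sym (ord-R j)) (centre-R j (trans (sym (A-R j)) e))
  ... | inL i  | centre = Consecutive-sym (subst (Consecutive n₁) (sym (ord-L i)) (centre-L i (trans (sym (A-L i)) e)))
  ... | inR j  | centre = Consecutive-sym (subst (Consecutive n₁) (sym (ord-R j)) (centre-R j (trans (sym (A-R j)) e)))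
  ... | inL i  | inL j  = subst₂ Consecutive (sym (ord-L i)) (sym (ord-L j)) (P₁.edge⇒consecutive i j (trans (sym (T-LL i j)) e))
  ... | inR i  | inR j  = subst₂ Consecutive (sym (ord-R i)) (sym (ord-R j))
                             (Equivalence.from (shift-Consecutive (P₂.ord i) (P₂.ord j)) (P₂.edge⇒consecutive i j (trans (sym (T-RR i j)) e)))
  ... | inL i  | inR j  = ⊥-elim (false≢true (trans (sym (T-LR i j)) e))
  ... | inR i  | inL j  = ⊥-elim (false≢true (trans (sym (T-RL i j)) e))

  consecutive⇒edge : ∀ y z → Consecutive (ord y) (ord z) → T y z ≡ true
  consecutive⇒edge y z c with part y | part z
  ... | centre | centre = ⊥-elim (centre≁centre c)
  ... | centre | inL i  = trans (A-L i) (L-centre i (subst (Consecutive n₁) (ord-L i) c))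
  ... | centre | inR j  = trans (A-R j) (R-centre j (subst (Consecutive n₁) (ord-R j) c))
  ... | inL i  | centre = trans (A-L i) (L-centre i (subst (Consecutive n₁) (ord-L i) (Consecutive-sym c)))
  ... | inR j  | centre = trans (A-R j) (R-centre j (subst (Consecutive n₁) (ord-R j) (Consecutive-sym c)))
  ... | inL i  | inL j  = trans (T-LL i j) (P₁.consecutive⇒edge i j (subst₂ Consecutive (ord-L i) (ord-L j) c))
  ... | inR i  | inR j  = trans (T-RR i j) (P₂.consecutive⇒edge i j
                             (Equivalence.to (shift-Consecutive (P₂.ord i) (P₂.ord j)) (subst₂ Consecutive (ord-R i) (ord-R j) c)))
  ... | inL i  | inR j  = ⊥-elim (L≁R i j (subst₂ Consecutive (ord-L i) (ord-R j) c))
  ... | inR i  | inL j  = ⊥-elim (L≁R j i (Consecutive-sym (subst₂ Consecutive (ord-R i) (ord-L j) c)))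

  ord<n : ∀ y → ord y < suc (n₁ + M)
  ord<n y with part y
  ... | centre = s≤s (m≤m+n n₁ M)
  ... | inL i  = subst (_< suc (n₁ + M)) (sym (ord-L i)) (≤-trans (P₁.ord<n i) (≤-trans (m≤m+n n₁ M) (n≤1+n _)))
  ... | inR j  = subst (_< suc (n₁ + M)) (sym (ord-R j)) (s≤s (+-monoʳ-< n₁ (≤-trans (P₂.ord<n j) (≤-reflexive (sym (+-identityʳ n₂))))))

  ord-injective : ∀ y z → ord y ≡ ord z → y ≡ z
  ord-injective y z eq with part y | part z
  ... | centre | centre = refl
  ... | centre | inL i  = ⊥-elim (<-irrefl (trans (sym (ord-L i)) (sym eq)) (P₁.ord<n i))
  ... | centre | inR j  = ⊥-elim (<-irrefl (trans eq (ord-R j)) (s≤s (m≤m+n n₁ _)))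
  ... | inL i  | centre = ⊥-elim (<-irrefl (trans (sym (ord-L i)) eq) (P₁.ord<n i))
  ... | inR j  | centre = ⊥-elim (<-irrefl (trans (sym eq) (ord-R j)) (s≤s (m≤m+n n₁ _)))
  ... | inL i  | inL j  = cong L (P₁.ord-injective i j (trans (sym (ord-L i)) (trans eq (ord-L j))))
  ... | inR i  | inR j  = cong R (P₂.ord-injective i j (+-cancelˡ-≡ n₁ _ _ (ℕ.suc-injective (trans (sym (ord-R i)) (trans eq (ord-R j))))))
  ... | inL i  | inR j  = ⊥-elim (<-irrefl (trans (sym (ord-L i)) (trans eq (ord-R j))) (L<R i j))
  ... | inR i  | inL j  = ⊥-elim (<-irrefl (trans (sym (ord-L j)) (trans (sym eq) (ord-R i))) (L<R j i))

  pathOrder : PathOrder T (L a) (R b)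
  pathOrder = record
    { ord              = ord
    ; ord<n            = ord<n
    ; ord-injective    = ord-injective
    ; edge⇒consecutive = edge⇒consecutive
    ; consecutive⇒edge = consecutive⇒edge
    ; ord-start        = trans (ord-L a) P₁.ord-start
    ; ord-end          = trans (cong suc (ord-R b)) (cong suc (trans (sym (+-suc n₁ (P₂.ord b)))
                                                      (cong (n₁ +_) (trans P₂.ord-end (sym (+-identityʳ n₂))))))
    }

  degree-L : ∀ i → degree T (L i) ≡ 𝟙 (markedAt v₁ i) + degree T₁ i
  degree-L i = cong₂ _+_ (cong 𝟙 (A-L i)) (degree-disjointUnion-↑ˡ T₁ _ i)
  degree-R : ∀ j → degree T (R j) ≡ 𝟙 (markedAt v₂ j) + degree T₂ j
  degree-R j = cong₂ _+_ (cong 𝟙 (A-R j)) (trans (degree-disjointUnion-↑ʳ T₁ _ (j ↑ˡ 0)) (degree-disjointUnion-↑ˡ T₂ emptyGraph j))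
  degree-centre : degree T zero ≡ 2
  degree-centre = trans (countFin-↑ n₁ M A)
    (cong₂ _+_ (trans (countFin-cong n₁ A-L) (countFin-≟ n₁ v₁))
               (trans (countFin-cong M (Components.attach-↑ʳ T₁ (disjointUnion T₂ emptyGraph) v₁ (attach v₂ A₀)))
                      (trans (countFin-↑ n₂ 0 (attach v₂ A₀))
                             (cong (_+ 0) (trans (countFin-cong n₂ (Components.attach-↑ˡ T₂ emptyGraph v₂ A₀)) (countFin-≟ n₂ v₂))))))

  leavesAmong : TrivialIfIsolated T₁ → TrivialIfIsolated T₂ → LeavesAmong T₁ a v₁ → LeavesAmong T₂ v₂ b → LeavesAmong T (L a) (R b)
  leavesAmong trivial₁ trivial₂ leaves₁ leaves₂ y leaf with part y
  ... | centre = ⊥-elim (<-irrefl refl (≤-trans (s≤s (s≤s z≤n)) (subst (_≤ 1) degree-centre leaf)))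
  ... | inL i with i ≟ v₁ | subst (_≤ 1) (degree-L i) leaf
  ...   | yes refl | leaf′ = inj₁ (cong L (sym (trivial₁ v₁ (n≤0⇒n≡0 (≤-pred leaf′)) a)))
  ...   | no i≢v₁  | leaf′ = inj₁ (cong L (Sum.[ id , ⊥-elim ∘ i≢v₁ ] (leaves₁ i leaf′)))
  leavesAmong trivial₁ trivial₂ leaves₁ leaves₂ y leaf | inR j with j ≟ v₂ | subst (_≤ 1) (degree-R j) leaf
  ...   | yes refl | leaf′ = inj₂ (cong R (sym (trivial₂ v₂ (n≤0⇒n≡0 (≤-pred leaf′)) b)))
  ...   | no j≢v₂  | leaf′ = inj₂ (cong R (Sum.[ ⊥-elim ∘ j≢v₂ , id ] (leaves₂ j leaf′)))

PathBetween-glue : ∀ {n₁ n₂} (T₁ : Graph n₁) (T₂ : Graph n₂) v₁ v₂ A₀ a b → TrivialIfIsolated T₁ → TrivialIfIsolated T₂ →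
                   PathBetween T₁ a v₁ → PathBetween T₂ v₂ b →
                   PathBetween (addVertex (attach v₁ (attach v₂ A₀)) (disjointUnion T₁ (disjointUnion T₂ emptyGraph)))
                               (suc (a ↑ˡ (n₂ + 0))) (suc (n₁ ↑ʳ (b ↑ˡ 0)))
PathBetween-glue T₁ T₂ v₁ v₂ A₀ a b trivial₁ trivial₂ (P₁ , leaves₁) (P₂ , leaves₂) =
  pathOrder , leavesAmong trivial₁ trivial₂ leaves₁ leaves₂
  where open GluedPaths T₁ T₂ v₁ v₂ A₀ a b P₁ P₂

-- Almost trees of stars: a leaf bound with one free leaf

LeafBoundOrPath : ∀ {n} → Graph n → Set
LeafBoundOrPath T = ∀ v x → IsLeaf T v → IsLeaf T x → x ≢ v → ∀ p q →
                    (∀ y → y ≢ v → y ≢ x → AdmissibleAt T unmarked p q y) → 0 < q x →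
                    (Zout T v p q <φ· Zin T v p q) ⊎ PathBetween T v x

weight-one-at-marked : ∀ {n} (T : Graph n) → TreeInvariant T → ∀ v x p q → x ≢ v → AdmissibleAt T (markedAt v) p q v →
                       p v ≡ 1 × q v ≡ 1
weight-one-at-marked T inv v x p q x≢v adm =
  proj₂ adm (λ v-glued → x≢v (TreeInvariant.trivialIfIsolated inv v (GluedLeaf-markedAt-self T v v-glued) x))

module LeafBoundOrPathAt {n} (T : Graph n) (inv : TreeInvariant T) (bound : LeafBoundOrPath T) (v : Fin n) (v-leaf : IsLeaf T v) where
  open TreeInvariant inv

  forbid->φ·-or-path : ∀ x → GluedLeaf T (markedAt v) x → ∀ p q → (∀ y → y ≢ x → AdmissibleAt T (markedAt v) p q y) → 0 < q x →
                       (Z T p q >φ· Z T (update p v 0) q) ⊎ PathBetween T v x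
  forbid->φ·-or-path x x-leaf p q adm qx>0 with x ≟ v
  ... | yes refl = inj₂ (PathBetween-isolated T trivialIfIsolated x (n≤0⇒n≡0 (≤-pred x-leaf)))
  ... | no x≢v with bound v x v-leaf x-leaf x≢v p q (λ y y≢v y≢x → AdmissibleAt-markedAt T v p q y y≢v (adm y y≢x)) qx>0
  ...   | inj₂ path    = inj₂ path
  ...   | inj₁ Out<φIn with weight-one-at-marked T inv v x p q x≢v (adm v (x≢v ∘ sym))
  ...     | pv≡1 , qv≡1 = inj₁ (Zout<φ·Zin⇒forbid->φ· T v p q pv≡1 qv≡1 Out<φIn)

  gluedBound-free-leaf : ∀ i x → GluedLeaf T (markedAt v) i → GluedLeaf T (markedAt v) x → x ≢ i → ∀ p q →
                         (∀ y → y ≢ i → y ≢ x → AdmissibleAt T (markedAt v) p q y) → 0 < q x → ∀ X Y → 0 < X → X >φ· Y →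
                         ZgluedOut T (markedAt v) i p q X Y <φ· ZgluedIn T (markedAt v) i p q X Y
  gluedBound-free-leaf i x i-leaf x-leaf x≢i p q adm qx>0 X Y X>0 X>φY with i ≟ v | x ≟ v
  ... | yes refl | _        = ⊥-elim (x≢i (trivialIfIsolated i (n≤0⇒n≡0 (≤-pred i-leaf)) x))
  ... | no _     | yes refl = ⊥-elim (x≢i (sym (trivialIfIsolated x (n≤0⇒n≡0 (≤-pred x-leaf)) i)))
  ... | no i≢v   | no x≢v
    with pv≡1 , qv≡1 ← weight-one-at-marked T inv v i p q i≢v (adm v (i≢v ∘ sym) (x≢v ∘ sym))
    with bound i x i-leaf x-leaf x≢i (update p v X) (update q v (X + Y))
           (λ y y≢i y≢x → pendant-admissible T v p q X Y v-leaf X>0 X>φY y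
                            (λ y≢v → AdmissibleAt-markedAt T v p q y y≢v (adm y y≢i y≢x)))
           (subst (0 <_) (sym (update-other q v (X + Y) x x≢v)) qx>0)
  ... | inj₁ Out<φIn =
    Zout<φ·Zin⇒gluedBound-markedAt T v i p q X Y i≢v pv≡1 qv≡1 Out<φIn
  ... | inj₂ (_ , leaves) = ⊥-elim (Sum.[ i≢v ∘ sym , x≢v ∘ sym ] (leaves v v-leaf))

  gluedBound-or-path : ∀ i → GluedLeaf T (markedAt v) i → ∀ p q → (∀ y → y ≢ i → AdmissibleAt T (markedAt v) p q y) →
                       ∀ X Y → 0 < X →
                       (ZgluedOut T (markedAt v) i p q X Y <φ· ZgluedIn T (markedAt v) i p q X Y) ⊎ PathBetween T i v
  gluedBound-or-path i i-leaf p q adm X Y X>0 with i ≟ v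
  ... | yes refl = inj₂ (PathBetween-isolated T trivialIfIsolated i (n≤0⇒n≡0 (≤-pred i-leaf)))
  ... | no i≢v
    with pv≡1 , qv≡1 ← weight-one-at-marked T inv v i p q i≢v (adm v (i≢v ∘ sym))
    with bound i v i-leaf v-leaf (i≢v ∘ sym) (update p v X) (update q v (X + Y))
           (λ y y≢i y≢v → subst₂ (Admissible (IsLeaf T y)) (sym (update-other p v X y y≢v)) (sym (update-other q v (X + Y) y y≢v))
                            (AdmissibleAt-markedAt T v p q y y≢v (adm y y≢i)))
           (subst (0 <_) (sym (update-same q v (X + Y))) (≤-trans X>0 (m≤m+n X Y)))
  ... | inj₁ Out<φIn =
    inj₁ (Zout<φ·Zin⇒gluedBound-markedAt T v i p q X Y i≢v pv≡1 qv≡1 Out<φIn)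
  ... | inj₂ path = inj₂ path

LeafBoundOrPath-single : LeafBoundOrPath {1} (λ _ _ → false)
LeafBoundOrPath-single zero zero _ _ 0≢0 = ⊥-elim (0≢0 refl)

LeafBoundOrPath-relabel : ∀ {n G H} → LeafBoundOrPath {n} G → (σ : Permutation′ n) → Relabelling G H σ → LeafBoundOrPath H
LeafBoundOrPath-relabel {n} {G} {H} bound σ H≅G v x v-leaf x-leaf x≢v p q adm qx>0
  with bound (σʳ v) (σʳ x) (IsLeaf-σʳ v-leaf) (IsLeaf-σʳ x-leaf) (x≢v ∘ σʳ-injective) (p ∘ σˡ) (q ∘ σˡ)
             (λ y y≢σv y≢σx → AdmissibleAt-σˡ p q y (adm (σˡ y) (≢-σˡ y≢σv) (≢-σˡ y≢σx)))
             (subst (λ z → 0 < q z) (sym (inverseˡ σ)) qx>0)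
  where open Relabel {G = G} σ H≅G
... | inj₁ Out<φIn = inj₁ (subst₂ _<φ·_ (sym (Z-update-σ v p q 0 1)) (sym (Z-update-σ v p q 1 0)) Out<φIn)
  where open Relabel {G = G} σ H≅G
... | inj₂ path = inj₂ (PathBetween-relabel G H σ H≅G v x path)

-- If X > φ Y the glued vertex sums into an admissible leaf weight, and no path exception arises.
ForestGluedBoundOrPath : ∀ {N} → Graph N → Marking N → ℕ → Set
ForestGluedBoundOrPath G A k = ∀ v x → GluedLeaf G A v → GluedLeaf G A x → x ≢ v → ∀ p q →
  (∀ y → y ≢ v → y ≢ x → AdmissibleAt G A p q y) → 0 < q x → ∀ X Y → Y ≤ X → 0 < X → (2 ≤ k ⊎ X >φ· Y) →
  (ZgluedOut G A v p q X Y <φ· ZgluedIn G A v p q X Y) ⊎ (¬ (X >φ· Y) × PathBetween (addVertex A G) (suc v) (suc x))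

LeafBoundOrPath-glue : ∀ {k N G A} → 2 ≤ k → ForestShape {N} G A k → ForestGluedBoundOrPath G A k → LeafBoundOrPath (addVertex A G)
LeafBoundOrPath-glue 2≤k shape bound zero    _       v-leaf _      = ⊥-elim (Glue.centre-not-leaf 2≤k shape v-leaf)
LeafBoundOrPath-glue 2≤k shape bound (suc v) zero    _      x-leaf = ⊥-elim (Glue.centre-not-leaf 2≤k shape x-leaf)
LeafBoundOrPath-glue {G = G} {A} 2≤k shape bound (suc v) (suc x) v-leaf x-leaf x≢v p q adm qx>0
  with bound v x v-leaf x-leaf (x≢v ∘ cong suc) (p ∘ suc) (q ∘ suc)
             (λ y y≢v y≢x → adm (suc y) (y≢v ∘ suc-injective) (y≢x ∘ suc-injective)) qx>0 1 1 ≤-refl (s≤s z≤n) (inj₁ 2≤k)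
... | inj₁ Out<φIn = inj₁ (subst₂ _<φ·_ (sym (Zglued-addVertex-update A G p q p₀≡1 q₀≡1 v 0 1))
                                        (sym (Zglued-addVertex-update A G p q p₀≡1 q₀≡1 v 1 0)) Out<φIn)
  where
    p₀≡1 : p zero ≡ 1
    p₀≡1 = proj₁ (proj₂ (adm zero (λ ()) (λ ())) (Glue.centre-not-leaf 2≤k shape))
    q₀≡1 : q zero ≡ 1
    q₀≡1 = proj₂ (proj₂ (adm zero (λ ()) (λ ())) (Glue.centre-not-leaf 2≤k shape))
... | inj₂ (_ , path) = inj₂ path

ComponentBounds : ∀ {k N G A} → StarForest k N G A → Set
ComponentBounds nil                     = ⊤
ComponentBounds (cons {T = T} _ _ _ F) = LeafBoundOrPath T × ComponentBounds F

SinglePath : ∀ {k N G A} → StarForest k N G A → Fin N → Set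
SinglePath (cons {n} {T = T₂} _ v₂ _ nil) x = Σ (Fin n) λ x₂ → x ≡ x₂ ↑ˡ 0 × PathBetween T₂ v₂ x₂
SinglePath _                             x = ⊥

forestMaskBound-or-path : ∀ {k N G A} (F : StarForest k N G A) → ComponentBounds F → ∀ x → GluedLeaf G A x → ∀ p q →
                          (∀ y → y ≢ x → AdmissibleAt G A p q y) → 0 < q x → (Z G p q >φ· Z G (mask A p) q) ⊎ SinglePath F x
forestMaskBound-or-path (cons {n} {k} {N} {T} {G′} {A′} t v v-leaf F′) (bound , _) x x-leaf p q adm qx>0
  with splitView n N x
... | left i with LeafBoundOrPathAt.forbid->φ·-or-path T (treeInvariant t) bound v v-leaf i (subst id (GluedLeaf-↑ˡ i) x-leaf)
                   (pˡ p) (pˡ q) (λ y y≢i → AdmissibleAt-↑ˡ p q y (adm (y ↑ˡ N) (y≢i ∘ ↑ˡ-injective N y i))) qx>0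
  where open Components T G′ v A′
...   | inj₁ T>φ· = inj₁ (Z>φ·Z-mask p q T>φ· (λ j → AdmissibleAt⇒out-positive G A p q (n ↑ʳ j) (adm (n ↑ʳ j) (↑ˡ≢↑ʳ i j ∘ sym))))
  where open Components T G′ v A′
...   | inj₂ path = rest F′ path
  where
    open Components T G′ v A′
    rest : (F′ : StarForest k N G′ A′) → PathBetween T v i →
           (Z G p q >φ· Z G (mask A p) q) ⊎ SinglePath (cons t v v-leaf F′) (i ↑ˡ N)
    rest nil                   path = inj₂ (i , refl , path)
    rest F′@(cons _ _ _ _)     path = inj₁ (Z>φ·Z-maskʳ p q
      (forestMaskBound F′ (s≤s z≤n) (pʳ p) (pʳ q) (λ j → AdmissibleAt-↑ʳ p q j (adm (n ↑ʳ j) (↑ˡ≢↑ʳ i j ∘ sym))))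
      (out-positive T (markedAt v) (pˡ p) (pˡ q) i qx>0 (λ y y≢i → AdmissibleAt-↑ˡ p q y (adm (y ↑ˡ N) (y≢i ∘ ↑ˡ-injective N y i)))))
forestMaskBound-or-path (cons {n} {k} {N} {T} {G′} {A′} t v v-leaf F′) _ x x-leaf p q adm qx>0 | right j =
  inj₁ (Z>φ·Z-mask p q (forbid->φ· T (treeInvariant t) v v-leaf (pˡ p) (pˡ q) admˡ)
         (out-positive G′ A′ (pʳ p) (pʳ q) j qx>0 (λ y y≢j → AdmissibleAt-↑ʳ p q y (adm (n ↑ʳ y) (y≢j ∘ ↑ʳ-injective n y j)))))
  where
    open Components T G′ v A′
    admˡ : ∀ i → AdmissibleAt T (markedAt v) (pˡ p) (pˡ q) i
    admˡ i = AdmissibleAt-↑ˡ p q i (adm (i ↑ˡ N) (↑ˡ≢↑ʳ i j))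

module GluedBoundOrPathCons {n k N : ℕ} {T : Graph n} {G′ : Graph N} {A′ : Marking N}
                            (t : TreeOfStars n T) (v : Fin n) (v-leaf : IsLeaf T v) (F′ : StarForest k N G′ A′)
                            (bound : LeafBoundOrPath T) (bounds′ : ComponentBounds F′) (bound′ : ForestGluedBoundOrPath G′ A′ k) where
  open Components T G′ v A′
  inv : TreeInvariant T
  inv = treeInvariant t

  open LeafBoundOrPathAt T inv bound v v-leaf

  Result : Fin (n + N) → Fin (n + N) → (p q : Fin (n + N) → ℕ) → ℕ → ℕ → Set
  Result x y p q X Y = (ZgluedOut G A x p q X Y <φ· ZgluedIn G A x p q X Y) ⊎ (¬ (X >φ· Y) × PathBetween (addVertex A G) (suc x) (suc y))

  Except : Fin (n + N) → Fin (n + N) → (p q : Fin (n + N) → ℕ) → Set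
  Except x y p q = ∀ z → z ≢ x → z ≢ y → AdmissibleAt G A p q z

  admˡ : ∀ {x y} p q → Except x y p q → ∀ i → i ↑ˡ N ≢ x → i ↑ˡ N ≢ y → AdmissibleAt T (markedAt v) (pˡ p) (pˡ q) i
  admˡ p q adm i i≢x i≢y = AdmissibleAt-↑ˡ p q i (adm (i ↑ˡ N) i≢x i≢y)

  admʳ : ∀ {x y} p q → Except x y p q → ∀ j → n ↑ʳ j ≢ x → n ↑ʳ j ≢ y → AdmissibleAt G′ A′ (pʳ p) (pʳ q) j
  admʳ p q adm j j≢x j≢y = AdmissibleAt-↑ʳ p q j (adm (n ↑ʳ j) j≢x j≢y)

  ≢-↑ˡ : ∀ {i i′ : Fin n} → i ≢ i′ → i ↑ˡ N ≢ i′ ↑ˡ N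
  ≢-↑ˡ {i} {i′} i≢i′ = i≢i′ ∘ ↑ˡ-injective N i i′

  ≢-↑ʳ : ∀ {j j′ : Fin N} → j ≢ j′ → n ↑ʳ j ≢ n ↑ʳ j′
  ≢-↑ʳ {j} {j′} j≢j′ = j≢j′ ∘ ↑ʳ-injective n j j′

  ↑ʳ≢↑ˡ : ∀ (j : Fin N) (i : Fin n) → n ↑ʳ j ≢ i ↑ˡ N
  ↑ʳ≢↑ˡ j i = ↑ˡ≢↑ʳ i j ∘ sym

  both-↑ˡ : ∀ i i′ → GluedLeaf G A (i ↑ˡ N) → GluedLeaf G A (i′ ↑ˡ N) → i′ ≢ i → ∀ p q → Except (i ↑ˡ N) (i′ ↑ˡ N) p q →
            0 < q (i′ ↑ˡ N) → ∀ X Y → Y ≤ X → 0 < X → (2 ≤ suc k ⊎ X >φ· Y) → Result (i ↑ˡ N) (i′ ↑ˡ N) p q X Y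
  both-↑ˡ i i′ i-leaf i′-leaf i′≢i p q adm qx>0 X Y Y≤X X>0 2≤k⊎X>φY = inj₁ (gluedBound-↑ˡ p q i X Y
    (gluedBound-free-leaf i i′ (subst id (GluedLeaf-↑ˡ i) i-leaf) (subst id (GluedLeaf-↑ˡ i′) i′-leaf) i′≢i (pˡ p) (pˡ q)
      (λ y y≢i y≢i′ → admˡ p q adm y (≢-↑ˡ y≢i) (≢-↑ˡ y≢i′)) qx>0
      (outˡ p q X) (inˡ p q Y) (outˡ-positive p q X (λ j → AdmissibleAt⇒out-positive G′ A′ (pʳ p) (pʳ q) j (admʳ′ j)) X>0)
      (scaled->φ· G′ A′ (pʳ p) (pʳ q) admʳ′ X Y Y≤X X>0
        (Sum.map (λ { (s≤s 1≤k) → forestMaskBound F′ 1≤k (pʳ p) (pʳ q) admʳ′ }) id 2≤k⊎X>φY))))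
    where
      admʳ′ : ∀ j → AdmissibleAt G′ A′ (pʳ p) (pʳ q) j
      admʳ′ j = admʳ p q adm j (↑ʳ≢↑ˡ j i) (↑ʳ≢↑ˡ j i′)

  ↑ˡ-↑ʳ : ∀ i j′ → GluedLeaf G A (i ↑ˡ N) → GluedLeaf G A (n ↑ʳ j′) → ∀ p q → Except (i ↑ˡ N) (n ↑ʳ j′) p q →
          0 < q (n ↑ʳ j′) → ∀ X Y → Y ≤ X → 0 < X → Result (i ↑ˡ N) (n ↑ʳ j′) p q X Y
  ↑ˡ-↑ʳ i j′ i-leaf j′-leaf p q adm qx>0 X Y Y≤X X>0 =
    Sum.[ (λ G′>φ· → inj₁ (bounded (*-mono->φ· (Z G′ (pʳ p) (pʳ q)) (Z G′ (mask A′ (pʳ p)) (pʳ q)) X Y G′>φ· Y≤X X>0)))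
             , (λ single → single-path F′ single) ]
      (forestMaskBound-or-path F′ bounds′ j′ (subst id (GluedLeaf-↑ʳ j′) j′-leaf) (pʳ p) (pʳ q) admʳ′ qx>0)
    where
      admʳ′ : ∀ y → y ≢ j′ → AdmissibleAt G′ A′ (pʳ p) (pʳ q) y
      admʳ′ y y≢j′ = admʳ p q adm y (↑ʳ≢↑ˡ y i) (≢-↑ʳ y≢j′)
      i-leafˡ = subst id (GluedLeaf-↑ˡ i) i-leaf
      admˡ′ : ∀ y → y ≢ i → AdmissibleAt T (markedAt v) (pˡ p) (pˡ q) y
      admˡ′ y y≢i = admˡ p q adm y (≢-↑ˡ y≢i) (↑ˡ≢↑ʳ y j′)
      outˡ>0 : 0 < outˡ p q X
      outˡ>0 = outˡ-positive p q X (out-positive G′ A′ (pʳ p) (pʳ q) j′ qx>0 admʳ′) X>0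
      bounded : outˡ p q X >φ· inˡ p q Y → ZgluedOut G A (i ↑ˡ N) p q X Y <φ· ZgluedIn G A (i ↑ˡ N) p q X Y
      bounded out>φin = gluedBound-↑ˡ p q i X Y
        (gluedBound-markedAt T inv v v-leaf i i-leafˡ (pˡ p) (pˡ q) admˡ′ (outˡ p q X) (inˡ p q Y) outˡ>0 out>φin)
      single-path : (F′ : StarForest k N G′ A′) → SinglePath F′ j′ → Result (i ↑ˡ N) (n ↑ʳ j′) p q X Y
      single-path (cons {T = T₂} t₂ v₂ _ nil) (x₂ , refl , path₂) with X * Y + Y * Y <? X * X
      ... | yes X>φY = inj₁ (bounded (*-mono->φ·ʳ (Z G′ (pʳ p) (pʳ q)) (Z G′ (mask A′ (pʳ p)) (pʳ q)) X Y X>φY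
                                        (Z-mono G′ (mask-≤ A′ (pʳ p)) (λ _ → ≤-refl))
                                        (Z-positive G′ (pʳ p) (pʳ q) (out-positive G′ A′ (pʳ p) (pʳ q) j′ qx>0 admʳ′))))
      ... | no ¬X>φY with gluedBound-or-path i i-leafˡ (pˡ p) (pˡ q) admˡ′ (outˡ p q X) (inˡ p q Y) outˡ>0
      ...   | inj₁ glued = inj₁ (gluedBound-↑ˡ p q i X Y glued)
      ...   | inj₂ path  = inj₂ (¬X>φY , PathBetween-glue T T₂ v v₂ _ i x₂ (TreeInvariant.trivialIfIsolated inv)
                                            (TreeInvariant.trivialIfIsolated (treeInvariant t₂)) path path₂)

  ↑ʳ-↑ˡ : ∀ j i′ → GluedLeaf G A (n ↑ʳ j) → GluedLeaf G A (i′ ↑ˡ N) → ∀ p q → Except (n ↑ʳ j) (i′ ↑ˡ N) p q →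
          0 < q (i′ ↑ˡ N) → ∀ X Y → Y ≤ X → 0 < X → Result (n ↑ʳ j) (i′ ↑ˡ N) p q X Y
  ↑ʳ-↑ˡ j i′ j-leaf i′-leaf p q adm qx>0 X Y Y≤X X>0 =
    Sum.[ (λ T>φ· → inj₁ (recurse (inj₂ (outʳ>φ·inʳ p q X Y qˡ>0 (inj₁ T>φ·) Y≤X X>0))))
             , (λ pathT → path-in-T F′ bounds′ pathT) ]
      (forbid->φ·-or-path i′ (subst id (GluedLeaf-↑ˡ i′) i′-leaf) (pˡ p) (pˡ q) admˡ′ qx>0)
    where
      admˡ′ : ∀ y → y ≢ i′ → AdmissibleAt T (markedAt v) (pˡ p) (pˡ q) y
      admˡ′ y y≢i′ = admˡ p q adm y (↑ˡ≢↑ʳ y j) (≢-↑ˡ y≢i′)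
      admʳ′ : ∀ y → y ≢ j → AdmissibleAt G′ A′ (pʳ p) (pʳ q) y
      admʳ′ y y≢j = admʳ p q adm y (≢-↑ʳ y≢j) (↑ʳ≢↑ˡ y i′)
      qˡ>0 : ∀ y → 0 < q (y ↑ˡ N)
      qˡ>0 = out-positive T (markedAt v) (pˡ p) (pˡ q) i′ qx>0 admˡ′
      j-leafʳ = subst id (GluedLeaf-↑ʳ j) j-leaf
      recurse : (2 ≤ k ⊎ outʳ p q X >φ· inʳ p q Y) → ZgluedOut G A (n ↑ʳ j) p q X Y <φ· ZgluedIn G A (n ↑ʳ j) p q X Y
      recurse condition = gluedBound-↑ʳ p q j X Y (forestGluedBound F′ j j-leafʳ (pʳ p) (pʳ q) admʳ′ (outʳ p q X) (inʳ p q Y)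
        (inʳ≤outʳ p q X Y Y≤X) (outʳ-positive p q X qˡ>0 X>0) condition)
      path-in-T : (F′ : StarForest k N G′ A′) → ComponentBounds F′ → PathBetween T v i′ → Result (n ↑ʳ j) (i′ ↑ˡ N) p q X Y
      path-in-T (cons _ _ _ (cons _ _ _ _)) _ _ = inj₁ (recurse (inj₁ (s≤s (s≤s z≤n))))
      path-in-T (cons {n₂} {T = T₂} {A = A₀} t₂ v₂ v₂-leaf nil) (bound₂ , _) pathT with X * Y + Y * Y <? X * X
      ... | yes X>φY = inj₁ (recurse (inj₂ (outʳ>φ·inʳ p q X Y qˡ>0 (inj₂ X>φY) Y≤X X>0)))
      ... | no ¬X>φY with splitView n₂ 0 j
      ...   | left j₂
        with LeafBoundOrPathAt.gluedBound-or-path T₂ (treeInvariant t₂) bound₂ v₂ v₂-leaf j₂ (subst id (C₂.GluedLeaf-↑ˡ j₂) j-leafʳ)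
               (C₂.pˡ (pʳ p)) (C₂.pˡ (pʳ q)) (λ y y≢j₂ → C₂.AdmissibleAt-↑ˡ (pʳ p) (pʳ q) y (admʳ′ (y ↑ˡ 0) (y≢j₂ ∘ ↑ˡ-injective 0 y j₂)))
               (C₂.outˡ (pʳ p) (pʳ q) (outʳ p q X)) (C₂.inˡ (pʳ p) (pʳ q) (inʳ p q Y))
               (C₂.outˡ-positive (pʳ p) (pʳ q) (outʳ p q X) (λ ()) (outʳ-positive p q X qˡ>0 X>0))
        where module C₂ = Components T₂ emptyGraph v₂ A₀
      ...     | inj₁ glued = inj₁ (gluedBound-↑ʳ p q j X Y (C₂.gluedBound-↑ˡ (pʳ p) (pʳ q) j₂ (outʳ p q X) (inʳ p q Y) glued))
        where module C₂ = Components T₂ emptyGraph v₂ A₀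
      ...     | inj₂ path₂ = inj₂ (¬X>φY , PathBetween-reverse (PathBetween-glue T T₂ v v₂ A₀ i′ j₂
                                  (TreeInvariant.trivialIfIsolated inv) (TreeInvariant.trivialIfIsolated (treeInvariant t₂))
                                  (PathBetween-reverse pathT) (PathBetween-reverse path₂)))

  both-↑ʳ : ∀ j j′ → GluedLeaf G A (n ↑ʳ j) → GluedLeaf G A (n ↑ʳ j′) → j′ ≢ j → ∀ p q → Except (n ↑ʳ j) (n ↑ʳ j′) p q →
            0 < q (n ↑ʳ j′) → ∀ X Y → Y ≤ X → 0 < X → Result (n ↑ʳ j) (n ↑ʳ j′) p q X Y
  both-↑ʳ j j′ j-leaf j′-leaf j′≢j p q adm qx>0 X Y Y≤X X>0 =
    Sum.[ (λ glued → inj₁ (gluedBound-↑ʳ p q j X Y glued)) , (λ (¬out>φin , _) → ⊥-elim (¬out>φin out>φin)) ]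
      (bound′ j j′ (subst id (GluedLeaf-↑ʳ j) j-leaf) (subst id (GluedLeaf-↑ʳ j′) j′-leaf) j′≢j (pʳ p) (pʳ q)
        (λ y y≢j y≢j′ → admʳ p q adm y (≢-↑ʳ y≢j) (≢-↑ʳ y≢j′)) qx>0 (outʳ p q X) (inʳ p q Y)
        (inʳ≤outʳ p q X Y Y≤X) (outʳ-positive p q X qˡ>0 X>0) (inj₂ out>φin))
    where
      admˡ′ : ∀ i → AdmissibleAt T (markedAt v) (pˡ p) (pˡ q) i
      admˡ′ i = admˡ p q adm i (↑ˡ≢↑ʳ i j) (↑ˡ≢↑ʳ i j′)
      qˡ>0 : ∀ i → 0 < q (i ↑ˡ N)
      qˡ>0 i = AdmissibleAt⇒out-positive T (markedAt v) (pˡ p) (pˡ q) i (admˡ′ i)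
      out>φin : outʳ p q X >φ· inʳ p q Y
      out>φin = outʳ>φ·inʳ p q X Y qˡ>0 (inj₁ (forbid->φ· T inv v v-leaf (pˡ p) (pˡ q) admˡ′)) Y≤X X>0

ForestGluedBoundOrPath-cons : ∀ {n k N T G′ A′} (t : TreeOfStars n T) (v : Fin n) (v-leaf : IsLeaf T v) (F′ : StarForest k N G′ A′) →
                              LeafBoundOrPath T → ComponentBounds F′ → ForestGluedBoundOrPath G′ A′ k →
                              ForestGluedBoundOrPath (disjointUnion T G′) (attach v A′) (suc k)
ForestGluedBoundOrPath-cons {n} {k} {N} t v v-leaf F′ bound bounds′ bound′ x y x-leaf y-leaf y≢x p q adm qy>0 X Y Y≤X X>0 2≤k⊎X>φY
  with splitView n N x | splitView n N y
... | left i  | left i′  = both-↑ˡ i i′ x-leaf y-leaf (y≢x ∘ cong (_↑ˡ N)) p q adm qy>0 X Y Y≤X X>0 2≤k⊎X>φY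
  where open GluedBoundOrPathCons t v v-leaf F′ bound bounds′ bound′
... | left i  | right j′ = ↑ˡ-↑ʳ i j′ x-leaf y-leaf p q adm qy>0 X Y Y≤X X>0
  where open GluedBoundOrPathCons t v v-leaf F′ bound bounds′ bound′
... | right j | left i′  = ↑ʳ-↑ˡ j i′ x-leaf y-leaf p q adm qy>0 X Y Y≤X X>0
  where open GluedBoundOrPathCons t v v-leaf F′ bound bounds′ bound′
... | right j | right j′ = both-↑ʳ j j′ x-leaf y-leaf (y≢x ∘ cong (n ↑ʳ_)) p q adm qy>0 X Y Y≤X X>0
  where open GluedBoundOrPathCons t v v-leaf F′ bound bounds′ bound′

mutual
  leafBoundOrPath : ∀ {n T} → TreeOfStars n T → LeafBoundOrPath T
  leafBoundOrPath single            = LeafBoundOrPath-single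
  leafBoundOrPath (glue 2≤k F)      = LeafBoundOrPath-glue 2≤k (forestShape F) (forestGluedBoundOrPath F)
  leafBoundOrPath (relabel t σ H≅G) = LeafBoundOrPath-relabel (leafBoundOrPath t) σ H≅G

  componentBounds : ∀ {k N G A} (F : StarForest k N G A) → ComponentBounds F
  componentBounds nil            = tt
  componentBounds (cons t _ _ F) = leafBoundOrPath t , componentBounds F

  forestGluedBoundOrPath : ∀ {k N G A} → StarForest k N G A → ForestGluedBoundOrPath G A k
  forestGluedBoundOrPath (cons t v v-leaf F) =
    ForestGluedBoundOrPath-cons t v v-leaf F (leafBoundOrPath t) (componentBounds F) (forestGluedBoundOrPath F)

Z-addVertex-unchosen : ∀ {n} (A : Marking n) (G : Graph n) p q → p zero ≡ 0 → q zero ≡ 1 → Z (addVertex A G) p q ≡ Z G (p ∘ suc) (q ∘ suc)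
Z-addVertex-unchosen A G p q p₀≡0 q₀≡1 rewrite Z-addVertex A G p q | p₀≡0 | q₀≡1 = trans (+-identityʳ _) (+-identityʳ _)

-- The pendant vertex gets weight (0, 1), so it never enters a stable set and is the free leaf of LeafBoundOrPath.
almostTreeOfStars-F>φ·F-removeLeaf : ∀ m (T : Graph (suc m)) w → ¬ IsPath T → IsLeaf T w → TreeOfStars (suc (suc m)) (addPendant T w) →
                                     ∀ v → IsLeaf T v → v ≢ w → F T >φ· F (removeVertex T v)
almostTreeOfStars-F>φ·F-removeLeaf m T w ¬path _ t v v-leaf v≢w
  with leafBoundOrPath t (suc v) zero v-leaf′ (≤-reflexive (countFin-≟ (suc m) w)) (λ ()) p one
         (λ { zero _ 0≢0 → ⊥-elim (0≢0 refl) ; (suc y) _ _ → one-admissible T′ unmarked (suc y) }) (s≤s z≤n)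
  where
    T′ = addPendant T w
    p = update one zero 0
    v-leaf′ : IsLeaf T′ (suc v)
    v-leaf′ with v ≟ w
    ... | yes v≡w = ⊥-elim (v≢w v≡w)
    ... | no _    = v-leaf
... | inj₂ (path , _) = ⊥-elim (¬path (IsPath-removeVertex (addPendant T w) (suc v) path))
... | inj₁ Out<φIn = F>φ·F-removeVertex T v (subst₂ _<φ·_ (forget 0 1) (forget 1 0) Out<φIn)
  where
    forget : ∀ c d → Z (addPendant T w) (update (update one zero 0) (suc v) c) (update one (suc v) d) ≡ Z T (update one v c) (update one v d)
    forget c d = trans (Z-addVertex-unchosen (markedAt w) T (update (update one zero 0) (suc v) c) (update one (suc v) d) refl refl)
                       (Z-cong T (update-reindex suc (λ _ _ → suc-injective) (update one zero 0) v c)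
                                 (update-reindex suc (λ _ _ → suc-injective) one v d))

lemma3 : (∀ (m : ℕ) (T : Graph (suc m)) → TreeOfStars (suc m) T →
    (v : Fin (suc m)) → IsLeaf T v →
    F T >φ· F (removeVertex T v))
    × (∀ (m : ℕ) (T : Graph (suc m)) (w : Fin (suc m)) →
    ¬ IsPath T → IsLeaf T w → TreeOfStars (suc (suc m)) (addPendant T w) →
    (v : Fin (suc m)) → IsLeaf T v → v ≢ w →
    F T >φ· F (removeVertex T v))
lemma3 = treeOfStars-F>φ·F-removeLeaf , almostTreeOfStars-F>φ·F-removeLeaf
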